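{- Let $G$ be a finite abelian group and $S \subseteq G$ a nontrivial sum set. Then $S$ is a difference set with $S = S^{(-1)}$. In particular, no finite cyclic group contains a nontrivial sum set.
   Context: Let $|G| = v$, $|S| = k$. For $a \in G$, the number of ways to write $a$ as a product (resp. quotient) in $S$ is the number of ordered pairs $(x,y)\in S\times S$ with $xy = a$ (resp. $xy^{ -1} = a$). $S$ is a $(v,k,\mu)$ sum set if every nonidentity element of $G$ is a product in $S$ in exactly $\mu$ ways, and a $(v,k,\lambda)$ difference set if every nonidentity element of $G$ is a quotient in $S$ in exactly $\lambda$ ways. $S^{(-1)} = \{s^{ -1}: s\in S\}$. The trivial sum sets are $\varnothing$, $G$, the singletons $\{g\}$ with $g^2=1$, and the complements $G\setminus\{g\}$ with $g^2 = 1$; a sum set is nontrivial if it is not one of these. -}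

module Defs where

open import Data.Nat using (ℕ; zero; suc)
open import Data.Integer using (ℤ; +_; -[1+_])
open import Data.Bool using (Bool; true; false)
open import Data.Fin using (Fin)
open import Data.List using (List; map; length; filter; cartesianProduct)
open import Data.List using (allFin)
open import Data.Product using (_×_; _,_; Σ; ∃; proj₁; proj₂)
open import Data.Sum using (_⊎_)
open import Relation.Nullary using (¬_; Dec)
open import Relation.Binary.PropositionalEquality using (_≡_)
open import Relation.Binary.Definitions using (DecidableEquality)
open import Function.Bundles using (_↔_; Inverse)
open import Algebra.Structures using (IsAbelianGroup)

-- A finite abelian group: a carrier with propositional equality,
-- abelian group laws (stdlib IsAbelianGroup w.r.t. _≡_), and a
-- bijection with Fin v (so v = |G|).
record FiniteAbelianGroup : Set₁ where
  infixl 7 _∙_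
  field
    Carrier  : Set
    _∙_      : Carrier → Carrier → Carrier
    ε        : Carrier
    _⁻¹      : Carrier → Carrier
    isAbelianGroup : IsAbelianGroup _≡_ _∙_ ε _⁻¹
    order    : ℕ
    enum     : Fin order ↔ Carrier
    _≟_      : DecidableEquality Carrier

  elements : List Carrier
  elements = map (Inverse.to enum) (allFin order)

  Subset : Set
  Subset = Carrier → Bool

  pairsIn : Subset → List (Carrier × Carrier)
  pairsIn S = filter (λ p → Data.Bool._≟_ (S (proj₁ p)) true)
                     (filter (λ p → Data.Bool._≟_ (S (proj₂ p)) true)
                             (cartesianProduct elements elements))

  #products : Subset → Carrier → ℕ
  #products S a = length (filter (λ p → (proj₁ p ∙ proj₂ p) ≟ a) (pairsIn S))

  #quotients : Subset → Carrier → ℕ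
  #quotients S a = length (filter (λ p → (proj₁ p ∙ (proj₂ p ⁻¹)) ≟ a) (pairsIn S))

  IsSumSet : Subset → Set
  IsSumSet S = Σ ℕ λ μ → ∀ a → ¬ (a ≡ ε) → #products S a ≡ μ

  IsDifferenceSet : Subset → Set
  IsDifferenceSet S = Σ ℕ λ l → ∀ a → ¬ (a ≡ ε) → #quotients S a ≡ l

  IsSymmetric : Subset → Set
  IsSymmetric S = ∀ x → S (x ⁻¹) ≡ S x

  IsTrivial : Subset → Set
  IsTrivial S =
    (∀ x → S x ≡ false)
    ⊎ (∀ x → S x ≡ true)
    ⊎ (Σ Carrier λ g → (g ∙ g ≡ ε) × (∀ x → (S x ≡ true → x ≡ g) × (x ≡ g → S x ≡ true)))
    ⊎ (Σ Carrier λ g → (g ∙ g ≡ ε) × (∀ x → (S x ≡ false → x ≡ g) × (x ≡ g → S x ≡ false)))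

  IsNontrivial : Subset → Set
  IsNontrivial S = ¬ IsTrivial S

  _^ℕ_ : Carrier → ℕ → Carrier
  g ^ℕ zero  = ε
  g ^ℕ suc n = g ∙ (g ^ℕ n)

  _^_ : Carrier → ℤ → Carrier
  g ^ (+ n)     = g ^ℕ n
  g ^ -[1+ n ]  = (g ^ℕ suc n) ⁻¹

  IsCyclic : Set
  IsCyclic = Σ Carrier λ g → ∀ x → Σ ℤ λ n → g ^ n ≡ x

-- Work in the group ring ℤ[G], with s the indicator of S and t = s ∘ _⁻¹. Being a sum set means
-- s ⋆ s = μ𝕁 + c δ_ε for some integer c, and then also t ⋆ t = μ𝕁 + c δ_ε, while s ⋆ 𝕁 = t ⋆ 𝕁 = k𝕁
-- and 𝕁 ⋆ 𝕁 = v𝕁 (k = |S|, v = |G|). These relations give D³ = 4cD for D = s − t and Q³ = 4cv²Q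
-- for Q = v(s + t) − 2k𝕁. A function Y with Y ∘ _⁻¹ = ±Y and Y³ = κY, ±κ ≤ 0, vanishes (positivity
-- of ‖Y ⋆ Y‖²), so D = 0 if c ≥ 0, and Q = 0, i.e. S = ∅ or S = G, if c ≤ 0. Thus S = S⁻¹, and then
-- quotients in S are products in S.
--
-- In a cyclic group, μ is congruent mod 2 to the number of square roots in S of any h ≠ ε, since
-- pairs (x , y) with x ≠ y come with (y , x). Without involutions squaring is injective, so S is
-- constant off ε. Otherwise there is exactly one involution t, squaring is two-to-one, μ is even and
-- S is invariant under z ↦ z t off {ε , t}; then c = 0 makes S constant, and c = 1 forces |S| = 1
-- or |S| = v − 1.

module Submission where

open import Defs
open import Data.Product using (_×_; _,_)
open import Relation.Nullary using (¬_)

module IntegerSums where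

  open import Data.Nat using (zero; suc)
  open import Data.Fin using (Fin; zero; suc; punchIn; punchOut)
  open import Data.Fin.Properties using (punchInᵢ≢i; punchIn-punchOut; punchIn-injective)
  open import Data.Integer using (ℤ; +_; -_; _+_; _*_; 0ℤ; 1ℤ; -1ℤ; _≤_)
  import Data.Integer.Properties as ℤP
  open import Data.Product using (Σ; _,_; proj₁; proj₂)
  open import Data.Vec.Functional using (removeAt)
  open import Relation.Binary.PropositionalEquality
  open import Data.Integer.Solver using (module +-*-Solver)
  open import Algebra.Properties.Semiring.Sum ℤP.+-*-semiring public
    using (sum; ∑-comm; ∑-permute; ∑-distrib-+; sum-cong-≗; *-distribˡ-sum)
  open import Algebra.Properties.Semiring.Sum ℤP.+-*-semiring
    using (sum-remove; sum-replicate-zero)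

  sum-neg : ∀ {n} (f : Fin n → ℤ) → sum (λ i → - f i) ≡ - sum f
  sum-neg f = begin
    sum (λ i → - f i)     ≡⟨ sum-cong-≗ (λ i → sym (ℤP.-1*i≡-i (f i))) ⟩
    sum (λ i → -1ℤ * f i) ≡⟨ sym (*-distribˡ-sum -1ℤ f) ⟩
    -1ℤ * sum f           ≡⟨ ℤP.-1*i≡-i (sum f) ⟩
    - sum f               ∎
    where open ≡-Reasoning

  sum-const : ∀ n c → sum {n} (λ _ → c) ≡ + n * c
  sum-const zero    c = sym (ℤP.*-zeroˡ c)
  sum-const (suc n) c = begin
    c + sum {n} (λ _ → c) ≡⟨ cong (λ z → c + z) (sum-const n c) ⟩
    c + + n * c           ≡⟨ solve 2 (λ c n → c :+ n :* c := (con 1ℤ :+ n) :* c) refl c (+ n) ⟩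
    + suc n * c           ∎
    where
    open +-*-Solver
    open ≡-Reasoning

  sum-zero-except : ∀ {n} (f : Fin n → ℤ) j → (∀ i → i ≢ j → f i ≡ 0ℤ) → sum f ≡ f j
  sum-zero-except {suc n} f j f≡0 = begin
    sum f                     ≡⟨ sum-remove {i = j} f ⟩
    f j + sum (removeAt f j)  ≡⟨ cong (λ z → f j + z) (sum-cong-≗ (λ i → f≡0 (punchIn j i) (punchInᵢ≢i j i))) ⟩
    f j + sum {n} (λ _ → 0ℤ)  ≡⟨ cong (λ z → f j + z) (sum-replicate-zero n) ⟩
    f j + 0ℤ                  ≡⟨ ℤP.+-identityʳ (f j) ⟩
    f j                       ∎
    where open ≡-Reasoning

  sum-zero-except-two : ∀ {n} (f : Fin n → ℤ) i j → i ≢ j → (∀ k → k ≢ i → k ≢ j → f k ≡ 0ℤ) →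
                        sum f ≡ f i + f j
  sum-zero-except-two {suc n} f i j i≢j f≡0 = begin
    sum f                     ≡⟨ sum-remove {i = i} f ⟩
    f i + sum (removeAt f i)  ≡⟨ cong (λ z → f i + z) (sum-zero-except (removeAt f i) j′ off-j′) ⟩
    f i + f (punchIn i j′)    ≡⟨ cong (λ z → f i + f z) (punchIn-punchOut i≢j) ⟩
    f i + f j                 ∎
    where
    open ≡-Reasoning
    j′ = punchOut i≢j
    off-j′ : ∀ k → k ≢ j′ → f (punchIn i k) ≡ 0ℤ
    off-j′ k k≢j′ = f≡0 (punchIn i k) (punchInᵢ≢i i k)
      (λ eq → k≢j′ (punchIn-injective i k j′ (trans eq (sym (punchIn-punchOut i≢j)))))

  sum-nonneg : ∀ {n} (f : Fin n → ℤ) → (∀ i → 0ℤ ≤ f i) → 0ℤ ≤ sum f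
  sum-nonneg {zero}  f f≥0 = ℤP.≤-refl
  sum-nonneg {suc n} f f≥0 = ℤP.+-mono-≤ (f≥0 zero) (sum-nonneg (λ i → f (suc i)) (λ i → f≥0 (suc i)))

  sum-nonneg-≥term : ∀ {n} (f : Fin n → ℤ) → (∀ i → 0ℤ ≤ f i) → ∀ i → f i ≤ sum f
  sum-nonneg-≥term {suc n} f f≥0 i = begin
    f i                      ≡⟨ sym (ℤP.+-identityʳ (f i)) ⟩
    f i + 0ℤ                 ≤⟨ ℤP.+-monoʳ-≤ (f i) (sum-nonneg (removeAt f i) (λ j → f≥0 (punchIn i j))) ⟩
    f i + sum (removeAt f i) ≡⟨ sym (sum-remove {i = i} f) ⟩
    sum f                    ∎
    where open ℤP.≤-Reasoning

  sum-nonneg-≥two-terms : ∀ {n} (f : Fin n → ℤ) → (∀ i → 0ℤ ≤ f i) →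
                          ∀ i j → i ≢ j → f i + f j ≤ sum f
  sum-nonneg-≥two-terms {suc n} f f≥0 i j i≢j = begin
    f i + f j                ≡⟨ cong (λ z → f i + f z) (sym (punchIn-punchOut i≢j)) ⟩
    f i + removeAt f i j′    ≤⟨ ℤP.+-monoʳ-≤ (f i) (sum-nonneg-≥term (removeAt f i) (λ k → f≥0 (punchIn i k)) j′) ⟩
    f i + sum (removeAt f i) ≡⟨ sym (sum-remove {i = i} f) ⟩
    sum f                    ∎
    where
    open ℤP.≤-Reasoning
    j′ = punchOut i≢j

  sum²-symmetric-≡-diagonal+even : ∀ {n} (F : Fin n → Fin n → ℤ) → (∀ i j → F i j ≡ F j i) →
                                   Σ ℤ λ m → sum (λ i → sum (F i)) ≡ sum (λ i → F i i) + (m + m)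
  sum²-symmetric-≡-diagonal+even {zero}  F F-sym = 0ℤ , refl
  sum²-symmetric-≡-diagonal+even {suc n} F F-sym = a + m , (begin
    (F zero zero + a) + sum (λ i → F (suc i) zero + sum (F′ i))
      ≡⟨ cong (λ z → (F zero zero + a) + z) (∑-distrib-+ (λ i → F (suc i) zero) (λ i → sum (F′ i))) ⟩
    (F zero zero + a) + (sum (λ i → F (suc i) zero) + sum (λ i → sum (F′ i)))
      ≡⟨ cong₂ (λ u w → (F zero zero + a) + (u + w)) (sum-cong-≗ (λ i → F-sym (suc i) zero)) (proj₂ rec) ⟩
    (F zero zero + a) + (a + (d + (m + m)))
      ≡⟨ solve 4 (λ f a d m → (f :+ a) :+ (a :+ (d :+ (m :+ m))) := (f :+ d) :+ ((a :+ m) :+ (a :+ m)))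
               refl (F zero zero) a d m ⟩
    (F zero zero + d) + ((a + m) + (a + m)) ∎)
    where
    open +-*-Solver
    open ≡-Reasoning
    F′ : Fin n → Fin n → ℤ
    F′ i j = F (suc i) (suc j)
    rec = sum²-symmetric-≡-diagonal+even F′ (λ i j → F-sym (suc i) (suc j))
    m = proj₁ rec
    a = sum (λ j → F zero (suc j))
    d = sum (λ i → F′ i i)

module IntegerFacts where

  open import Data.Nat as ℕ using (zero; suc)
  import Data.Nat.Properties as ℕP
  open import Data.Integer as ℤ using (ℤ; +_; -[1+_]; _+_; _-_; _*_; 0ℤ; 1ℤ; _≤_)
  import Data.Integer.Properties as ℤP
  import Data.Sign.Properties as SignP
  open import Data.Sum using (inj₁; inj₂)
  open import Data.Empty using (⊥-elim)
  open import Relation.Binary.PropositionalEquality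
  open import Data.Integer.Solver using (module +-*-Solver)

  i*i≥0 : ∀ i → 0ℤ ≤ i * i
  i*i≥0 i rewrite SignP.s*s≡+ (ℤ.sign i) | ℤP.+◃n≡+n (ℤ.∣ i ∣ ℕ.* ℤ.∣ i ∣) = ℤ.+≤+ ℕ.z≤n

  i*i≡0⇒i≡0 : ∀ i → i * i ≡ 0ℤ → i ≡ 0ℤ
  i*i≡0⇒i≡0 i i*i≡0 with ℤP.i*j≡0⇒i≡0∨j≡0 i i*i≡0
  ... | inj₁ i≡0 = i≡0
  ... | inj₂ i≡0 = i≡0

  i≤0∧j≥0⇒i*j≤0 : ∀ i j → i ≤ 0ℤ → 0ℤ ≤ j → i * j ≤ 0ℤ
  i≤0∧j≥0⇒i*j≤0 i (+ n) i≤0 _ = ℤP.≤-trans (ℤP.*-monoʳ-≤-nonNeg (+ n) i≤0) (ℤP.≤-reflexive (ℤP.*-zeroˡ (+ n)))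

  i+i≢1 : ∀ i → i + i ≢ 1ℤ
  i+i≢1 (+ zero) ()
  i+i≢1 (+ suc n) eq with ℤP.+-injective (trans (ℤP.pos-+ (suc n) (suc n)) eq)
  ... | eq′ rewrite ℕP.+-suc n n with eq′
  ... | ()
  i+i≢1 -[1+ n ] ()

  1+[i+i]≢j+j : ∀ i j → 1ℤ + (i + i) ≢ j + j
  1+[i+i]≢j+j i j eq = i+i≢1 (j ℤ.- i) (begin
    (j - i) + (j - i)           ≡⟨ solve 2 (λ i j → (j :- i) :+ (j :- i) := (j :+ j) :- (i :+ i)) refl i j ⟩
    (j + j) - (i + i)           ≡⟨ cong (_- (i + i)) (sym eq) ⟩
    (1ℤ + (i + i)) - (i + i)    ≡⟨ solve 1 (λ i → (con 1ℤ :+ (i :+ i)) :- (i :+ i) := con 1ℤ) refl i ⟩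
    1ℤ                          ∎)
    where
    open +-*-Solver
    open ≡-Reasoning

  i≥0∧i≢0⇒i≥1 : ∀ i → 0ℤ ≤ i → i ≢ 0ℤ → 1ℤ ≤ i
  i≥0∧i≢0⇒i≥1 (+ zero)  _ i≢0 = ⊥-elim (i≢0 refl)
  i≥0∧i≢0⇒i≥1 (+ suc n) _ _   = ℤ.+≤+ (ℕ.s≤s ℕ.z≤n)

module LeastWitness where

  open import Data.Nat using (ℕ; _≤_; _<_)
  open import Data.Nat.Properties using (≮⇒≥)
  open import Data.Nat.Induction using (<-rec)
  open import Data.Fin using (Fin; toℕ; fromℕ<)
  open import Data.Fin.Properties using (any?; toℕ<n; toℕ-fromℕ<)
  open import Data.Product using (Σ; _×_; _,_)
  open import Relation.Nullary using (yes; no)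
  open import Relation.Unary using (Decidable)
  open import Relation.Binary.PropositionalEquality

  Least : ∀ {p} → (ℕ → Set p) → ℕ → Set p
  Least P d = P d × (∀ k → P k → d ≤ k)

  least-witness : ∀ {p} {P : ℕ → Set p} → Decidable P → ∀ n → P n → Σ ℕ (Least P)
  least-witness {P = P} P? = <-rec (λ n → P n → Σ ℕ (Least P)) step
    where
    step : ∀ n → (∀ {m} → m < n → P m → Σ ℕ (Least P)) → P n → Σ ℕ (Least P)
    step n smaller Pn with any? (λ (i : Fin n) → P? (toℕ i))
    ... | yes (i , Pi) = smaller (toℕ<n i) Pi
    ... | no ∄smaller  = n , Pn , λ k Pk → ≮⇒≥ (λ k<n → ∄smaller (fromℕ< k<n , subst P (sym (toℕ-fromℕ< k<n)) Pk))

module Indicators where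

  open import Data.Nat as ℕ using ()
  open import Data.Integer as ℤ using (ℤ; _+_; _-_; _*_; 0ℤ; 1ℤ; _≤_)
  import Data.Integer.Properties as ℤP
  open import Data.Bool as Bool using (Bool; true; false)
  open import Data.Empty using (⊥-elim)
  open import Relation.Nullary using (¬_; Dec; yes; no; does)
  open import Relation.Binary.PropositionalEquality
  open IntegerFacts using (1+[i+i]≢j+j)

  χ : Bool → ℤ
  χ true  = 1ℤ
  χ false = 0ℤ

  ⟦_⟧ : ∀ {p} {P : Set p} → Dec P → ℤ
  ⟦ d ⟧ = χ (does d)

  χ≥0 : ∀ b → 0ℤ ≤ χ b
  χ≥0 true  = ℤ.+≤+ ℕ.z≤n
  χ≥0 false = ℤ.+≤+ ℕ.z≤n

  ⟦⟧≥0 : ∀ {p} {P : Set p} (d : Dec P) → 0ℤ ≤ ⟦ d ⟧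
  ⟦⟧≥0 d = χ≥0 (does d)

  χb*χb≡χb : ∀ b → χ b * χ b ≡ χ b
  χb*χb≡χb true  = refl
  χb*χb≡χb false = refl

  χ-not : ∀ b → χ (Bool.not b) ≡ 1ℤ - χ b
  χ-not true  = refl
  χ-not false = refl

  χ-injective : ∀ a b → χ a ≡ χ b → a ≡ b
  χ-injective true  true  _ = refl
  χ-injective false false _ = refl
  χ-injective true  false ()
  χ-injective false true  ()

  χa+χb≡χe+χe⇒a≡e : ∀ a b e → χ a + χ b ≡ χ e + χ e → a ≡ e
  χa+χb≡χe+χe⇒a≡e true  true  true  _ = refl
  χa+χb≡χe+χe⇒a≡e false false false _ = refl
  χa+χb≡χe+χe⇒a≡e true  false true  ()
  χa+χb≡χe+χe⇒a≡e false true  true  ()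
  χa+χb≡χe+χe⇒a≡e false false true  ()
  χa+χb≡χe+χe⇒a≡e true  true  false ()
  χa+χb≡χe+χe⇒a≡e true  false false ()
  χa+χb≡χe+χe⇒a≡e false true  false ()

  χa+even≡χb+even⇒a≡b : ∀ a b m n → χ a + (m + m) ≡ χ b + (n + n) → a ≡ b
  χa+even≡χb+even⇒a≡b true  true  m n eq = refl
  χa+even≡χb+even⇒a≡b false false m n eq = refl
  χa+even≡χb+even⇒a≡b true  false m n eq = ⊥-elim (1+[i+i]≢j+j m n (trans eq (ℤP.+-identityˡ (n + n))))
  χa+even≡χb+even⇒a≡b false true  m n eq = ⊥-elim (1+[i+i]≢j+j n m (trans (sym eq) (ℤP.+-identityˡ (m + m))))

  χa+χb+even≡even⇒a≡b : ∀ a b m n → (χ a + χ b) + (m + m) ≡ n + n → a ≡ b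
  χa+χb+even≡even⇒a≡b true  true  m n eq = refl
  χa+χb+even≡even⇒a≡b false false m n eq = refl
  χa+χb+even≡even⇒a≡b true  false m n eq = ⊥-elim (1+[i+i]≢j+j m n eq)
  χa+χb+even≡even⇒a≡b false true  m n eq = ⊥-elim (1+[i+i]≢j+j m n eq)

  ⟦⟧-yes : ∀ {p} {P : Set p} (d : Dec P) → P → ⟦ d ⟧ ≡ 1ℤ
  ⟦⟧-yes (yes _) _  = refl
  ⟦⟧-yes (no ¬p) p  = ⊥-elim (¬p p)

  ⟦⟧-no : ∀ {p} {P : Set p} (d : Dec P) → ¬ P → ⟦ d ⟧ ≡ 0ℤ
  ⟦⟧-no (yes p) ¬p = ⊥-elim (¬p p)
  ⟦⟧-no (no _)  _  = refl

  ⟦b≟true⟧≡χb : ∀ b → ⟦ b Bool.≟ true ⟧ ≡ χ b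
  ⟦b≟true⟧≡χb true  = refl
  ⟦b≟true⟧≡χb false = refl

module ListSums where

  open import Data.Nat using (zero; suc)
  open import Data.Fin using (Fin; zero; suc)
  open import Data.Integer using (ℤ; +_; _+_; _*_; 0ℤ; 1ℤ)
  import Data.Integer.Properties as ℤP
  open import Data.List using (List; []; _∷_; map; length; filter; cartesianProduct; tabulate; _++_)
  open import Data.Product using (_×_; _,_)
  open import Relation.Nullary using (yes; no)
  open import Relation.Unary using (Pred; Decidable)
  open import Relation.Binary.PropositionalEquality
  open IntegerSums using (sum)
  open Indicators using (⟦_⟧)

  lsum : ∀ {A : Set} → (A → ℤ) → List A → ℤ
  lsum w []       = 0ℤ
  lsum w (x ∷ xs) = w x + lsum w xs

  length≡lsum-1 : ∀ {A : Set} (xs : List A) → + length xs ≡ lsum (λ _ → 1ℤ) xs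
  length≡lsum-1 []       = refl
  length≡lsum-1 (x ∷ xs) = trans (sym (ℤP.pos-+ 1 (length xs))) (cong (_+_ 1ℤ) (length≡lsum-1 xs))

  lsum-filter : ∀ {A : Set} {p} {P : Pred A p} (P? : Decidable P) (w : A → ℤ) xs →
                lsum w (filter P? xs) ≡ lsum (λ x → ⟦ P? x ⟧ * w x) xs
  lsum-filter P? w []       = refl
  lsum-filter P? w (x ∷ xs) with P? x
  ... | yes _ = cong₂ _+_ (sym (ℤP.*-identityˡ (w x))) (lsum-filter P? w xs)
  ... | no _  = trans (lsum-filter P? w xs) (sym (ℤP.+-identityˡ _))

  lsum-++ : ∀ {A : Set} (w : A → ℤ) xs ys → lsum w (xs ++ ys) ≡ lsum w xs + lsum w ys
  lsum-++ w []       ys = sym (ℤP.+-identityˡ _)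
  lsum-++ w (x ∷ xs) ys = trans (cong (_+_ (w x)) (lsum-++ w xs ys)) (sym (ℤP.+-assoc (w x) _ _))

  lsum-map : ∀ {A B : Set} (w : B → ℤ) (f : A → B) xs → lsum w (map f xs) ≡ lsum (λ x → w (f x)) xs
  lsum-map w f []       = refl
  lsum-map w f (x ∷ xs) = cong (_+_ (w (f x))) (lsum-map w f xs)

  lsum-cartesianProduct : ∀ {A B : Set} (w : A × B → ℤ) xs ys →
                          lsum w (cartesianProduct xs ys) ≡ lsum (λ x → lsum (λ y → w (x , y)) ys) xs
  lsum-cartesianProduct w []       ys = refl
  lsum-cartesianProduct w (x ∷ xs) ys =
    trans (lsum-++ w (map (x ,_) ys) _) (cong₂ _+_ (lsum-map w (x ,_) ys) (lsum-cartesianProduct w xs ys))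

  lsum-tabulate : ∀ {A : Set} {n} (w : A → ℤ) (g : Fin n → A) → lsum w (tabulate g) ≡ sum (λ i → w (g i))
  lsum-tabulate {n = zero}  w g = refl
  lsum-tabulate {n = suc n} w g = cong (_+_ (w (g zero))) (lsum-tabulate w (λ i → g (suc i)))

  lsum-cong : ∀ {A : Set} {w w′ : A → ℤ} → (∀ x → w x ≡ w′ x) → ∀ xs → lsum w xs ≡ lsum w′ xs
  lsum-cong w≡w′ []       = refl
  lsum-cong w≡w′ (x ∷ xs) = cong₂ _+_ (w≡w′ x) (lsum-cong w≡w′ xs)

module GroupIdentities (G : FiniteAbelianGroup) where

  open import Relation.Binary.PropositionalEquality
  open import Algebra.Bundles using (AbelianGroup)
  open import Algebra.Structures using (IsAbelianGroup)

  open FiniteAbelianGroup G public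
  open IsAbelianGroup isAbelianGroup public
    using (assoc; comm; identityˡ; identityʳ; inverseˡ; inverseʳ)

  abelianGroup : AbelianGroup _ _
  abelianGroup = record { isAbelianGroup = isAbelianGroup }

  open import Algebra.Properties.AbelianGroup abelianGroup public
    using (⁻¹-involutive; ε⁻¹≈ε; ⁻¹-∙-comm; inverseʳ-unique; x∙y⁻¹≈ε⇒x≈y)

  x⁻¹∙[x∙y]≡y : ∀ x y → x ⁻¹ ∙ (x ∙ y) ≡ y
  x⁻¹∙[x∙y]≡y x y = begin
    x ⁻¹ ∙ (x ∙ y) ≡⟨ sym (assoc _ _ _) ⟩
    (x ⁻¹ ∙ x) ∙ y ≡⟨ cong (_∙ y) (inverseˡ x) ⟩
    ε ∙ y          ≡⟨ identityˡ y ⟩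
    y              ∎
    where open ≡-Reasoning

  x∙[x⁻¹∙y]≡y : ∀ x y → x ∙ (x ⁻¹ ∙ y) ≡ y
  x∙[x⁻¹∙y]≡y x y = begin
    x ∙ (x ⁻¹ ∙ y) ≡⟨ sym (assoc _ _ _) ⟩
    (x ∙ x ⁻¹) ∙ y ≡⟨ cong (_∙ y) (inverseʳ x) ⟩
    ε ∙ y          ≡⟨ identityˡ y ⟩
    y              ∎
    where open ≡-Reasoning

  ε⁻¹∙x≡x : ∀ x → ε ⁻¹ ∙ x ≡ x
  ε⁻¹∙x≡x x = trans (cong (_∙ x) ε⁻¹≈ε) (identityˡ x)

  [x∙y]⁻¹∙z≡y⁻¹∙[x⁻¹∙z] : ∀ x y z → (x ∙ y) ⁻¹ ∙ z ≡ y ⁻¹ ∙ (x ⁻¹ ∙ z)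
  [x∙y]⁻¹∙z≡y⁻¹∙[x⁻¹∙z] x y z = begin
    (x ∙ y) ⁻¹ ∙ z        ≡⟨ cong (_∙ z) (sym (⁻¹-∙-comm x y)) ⟩
    (x ⁻¹ ∙ y ⁻¹) ∙ z     ≡⟨ cong (_∙ z) (comm _ _) ⟩
    (y ⁻¹ ∙ x ⁻¹) ∙ z     ≡⟨ assoc _ _ _ ⟩
    y ⁻¹ ∙ (x ⁻¹ ∙ z)     ∎
    where open ≡-Reasoning

  [x∙y⁻¹]⁻¹∙x≡y : ∀ x y → (x ∙ y ⁻¹) ⁻¹ ∙ x ≡ y
  [x∙y⁻¹]⁻¹∙x≡y x y = begin
    (x ∙ y ⁻¹) ⁻¹ ∙ x     ≡⟨ cong (_∙ x) (sym (⁻¹-∙-comm x (y ⁻¹))) ⟩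
    (x ⁻¹ ∙ y ⁻¹ ⁻¹) ∙ x  ≡⟨ cong (λ u → (x ⁻¹ ∙ u) ∙ x) (⁻¹-involutive y) ⟩
    (x ⁻¹ ∙ y) ∙ x        ≡⟨ comm _ _ ⟩
    x ∙ (x ⁻¹ ∙ y)        ≡⟨ x∙[x⁻¹∙y]≡y x y ⟩
    y                     ∎
    where open ≡-Reasoning

  x∙x≡y∙y⇒[x∙y⁻¹]²≡ε : ∀ x y → x ∙ x ≡ y ∙ y → (x ∙ y ⁻¹) ∙ (x ∙ y ⁻¹) ≡ ε
  x∙x≡y∙y⇒[x∙y⁻¹]²≡ε x y eq = begin
    (x ∙ y ⁻¹) ∙ (x ∙ y ⁻¹)   ≡⟨ assoc x (y ⁻¹) (x ∙ y ⁻¹) ⟩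
    x ∙ (y ⁻¹ ∙ (x ∙ y ⁻¹))   ≡⟨ cong (x ∙_) (sym (assoc (y ⁻¹) x (y ⁻¹))) ⟩
    x ∙ ((y ⁻¹ ∙ x) ∙ y ⁻¹)   ≡⟨ cong (λ u → x ∙ (u ∙ y ⁻¹)) (comm (y ⁻¹) x) ⟩
    x ∙ ((x ∙ y ⁻¹) ∙ y ⁻¹)   ≡⟨ cong (x ∙_) (assoc x (y ⁻¹) (y ⁻¹)) ⟩
    x ∙ (x ∙ (y ⁻¹ ∙ y ⁻¹))   ≡⟨ sym (assoc x x _) ⟩
    (x ∙ x) ∙ (y ⁻¹ ∙ y ⁻¹)   ≡⟨ cong₂ _∙_ eq (⁻¹-∙-comm y y) ⟩
    (y ∙ y) ∙ (y ∙ y) ⁻¹      ≡⟨ inverseʳ (y ∙ y) ⟩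
    ε                         ∎
    where open ≡-Reasoning

module GroupSums (G : FiniteAbelianGroup) where

  open import Data.Fin using (Fin)
  open import Data.Integer using (ℤ; +_; -_; _+_; _*_; 0ℤ; _≤_)
  import Data.Integer.Properties as ℤP
  open import Data.Product using (Σ; _,_)
  open import Data.Fin.Properties using (any?)
  open import Relation.Nullary using (Dec; yes; no)
  open import Relation.Binary.PropositionalEquality
  open import Function using (_∘_)
  open import Function.Bundles using (Inverse)
  import Data.Fin.Permutation as Perm
  open IntegerSums
  open GroupIdentities G public

  toFin : Carrier → Fin order
  toFin = Inverse.from enum

  fromFin : Fin order → Carrier
  fromFin = Inverse.to enum

  fromFin-toFin : ∀ x → fromFin (toFin x) ≡ x
  fromFin-toFin = Inverse.strictlyInverseˡ enum

  toFin-fromFin : ∀ i → toFin (fromFin i) ≡ i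
  toFin-fromFin = Inverse.strictlyInverseʳ enum

  order≢0 : order ≢ 0
  order≢0 order≡0 with toFin ε
  ... | i rewrite order≡0 with i
  ... | ()

  ℤ[G] : Set
  ℤ[G] = Carrier → ℤ

  ∑G : ℤ[G] → ℤ
  ∑G f = sum (λ i → f (fromFin i))

  ∑G-cong : ∀ {f g : ℤ[G]} → (∀ x → f x ≡ g x) → ∑G f ≡ ∑G g
  ∑G-cong f≡g = sum-cong-≗ (λ i → f≡g (fromFin i))

  ∑G-reindex : (φ ψ : Carrier → Carrier) → (∀ x → φ (ψ x) ≡ x) → (∀ x → ψ (φ x) ≡ x) →
               (f : ℤ[G]) → ∑G f ≡ ∑G (λ x → f (φ x))
  ∑G-reindex φ ψ φψ ψφ f = trans (∑-permute (λ i → f (fromFin i)) π)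
                                 (sum-cong-≗ (λ i → cong f (fromFin-toFin (φ (fromFin i)))))
    where
    conj : (Carrier → Carrier) → Fin order → Fin order
    conj h i = toFin (h (fromFin i))
    conj-inverse : ∀ h h′ → (∀ x → h (h′ x) ≡ x) → ∀ i → conj h (conj h′ i) ≡ i
    conj-inverse h h′ hh′ i =
      trans (cong (toFin ∘ h) (fromFin-toFin _)) (trans (cong toFin (hh′ _)) (toFin-fromFin i))
    π : Perm.Permutation order order
    π = Perm.permutation (conj φ) (conj ψ) (conj-inverse φ ψ φψ) (conj-inverse ψ φ ψφ)

  ∑G-reindex-⁻¹ : (f : ℤ[G]) → ∑G f ≡ ∑G (λ x → f (x ⁻¹))
  ∑G-reindex-⁻¹ = ∑G-reindex _⁻¹ _⁻¹ ⁻¹-involutive ⁻¹-involutive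

  ∑G-reindex-translate : ∀ y (f : ℤ[G]) → ∑G f ≡ ∑G (λ x → f (y ∙ x))
  ∑G-reindex-translate y = ∑G-reindex (y ∙_) (y ⁻¹ ∙_) (x∙[x⁻¹∙y]≡y y) (x⁻¹∙[x∙y]≡y y)

  toFin-injective : ∀ {x y} → toFin x ≡ toFin y → x ≡ y
  toFin-injective {x} {y} eq = trans (sym (fromFin-toFin x)) (trans (cong fromFin eq) (fromFin-toFin y))

  fromFin-≢ : ∀ {i x} → i ≢ toFin x → fromFin i ≢ x
  fromFin-≢ {i} i≢x eq = i≢x (trans (sym (toFin-fromFin i)) (cong toFin eq))

  ∑G-zero-except : (f : ℤ[G]) (b : Carrier) → (∀ x → x ≢ b → f x ≡ 0ℤ) → ∑G f ≡ f b
  ∑G-zero-except f b f≡0 =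
    trans (sum-zero-except (λ i → f (fromFin i)) (toFin b) (λ i i≢b → f≡0 (fromFin i) (fromFin-≢ i≢b)))
          (cong f (fromFin-toFin b))

  ∑G-zero-except-two : (f : ℤ[G]) (a b : Carrier) → a ≢ b → (∀ x → x ≢ a → x ≢ b → f x ≡ 0ℤ) →
                       ∑G f ≡ f a + f b
  ∑G-zero-except-two f a b a≢b f≡0 =
    trans (sum-zero-except-two (λ i → f (fromFin i)) (toFin a) (toFin b) (λ eq → a≢b (toFin-injective eq))
            (λ i i≢a i≢b → f≡0 (fromFin i) (fromFin-≢ i≢a) (fromFin-≢ i≢b)))
          (cong₂ _+_ (cong f (fromFin-toFin a)) (cong f (fromFin-toFin b)))

  any?G : ∀ {p} {P : Carrier → Set p} → (∀ x → Dec (P x)) → Dec (Σ Carrier P)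
  any?G {P = P} P? with any? (λ i → P? (fromFin i))
  ... | yes (i , p) = yes (fromFin i , p)
  ... | no ¬p       = no (λ (x , px) → ¬p (toFin x , subst P (sym (fromFin-toFin x)) px))

  ∑G-+ : (f g : ℤ[G]) → ∑G (λ x → f x + g x) ≡ ∑G f + ∑G g
  ∑G-+ f g = ∑-distrib-+ (λ i → f (fromFin i)) (λ i → g (fromFin i))

  ∑G-*ˡ : ∀ c (f : ℤ[G]) → ∑G (λ x → c * f x) ≡ c * ∑G f
  ∑G-*ˡ c f = sym (*-distribˡ-sum c (λ i → f (fromFin i)))

  ∑G-*ʳ : ∀ c (f : ℤ[G]) → ∑G (λ x → f x * c) ≡ ∑G f * c
  ∑G-*ʳ c f = trans (∑G-cong (λ x → ℤP.*-comm (f x) c)) (trans (∑G-*ˡ c f) (ℤP.*-comm c (∑G f)))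

  ∑G-neg : (f : ℤ[G]) → ∑G (λ x → - f x) ≡ - ∑G f
  ∑G-neg f = sum-neg (λ i → f (fromFin i))

  ∑G-comm : (F : Carrier → Carrier → ℤ) → ∑G (λ x → ∑G (F x)) ≡ ∑G (λ y → ∑G (λ x → F x y))
  ∑G-comm F = ∑-comm (λ i j → F (fromFin i) (fromFin j))

  ∑G-const : ∀ c → ∑G (λ _ → c) ≡ + order * c
  ∑G-const c = sum-const order c

  ∑G-nonneg : (f : ℤ[G]) → (∀ x → 0ℤ ≤ f x) → 0ℤ ≤ ∑G f
  ∑G-nonneg f f≥0 = sum-nonneg _ (λ i → f≥0 (fromFin i))

  ∑G-nonneg-≥term : (f : ℤ[G]) → (∀ x → 0ℤ ≤ f x) → ∀ x → f x ≤ ∑G f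
  ∑G-nonneg-≥term f f≥0 x = ℤP.≤-trans (ℤP.≤-reflexive (cong f (sym (fromFin-toFin x))))
                                     (sum-nonneg-≥term _ (λ i → f≥0 (fromFin i)) (toFin x))

  ∑G-nonneg-≥two-terms : (f : ℤ[G]) → (∀ x → 0ℤ ≤ f x) → ∀ x y → x ≢ y → f x + f y ≤ ∑G f
  ∑G-nonneg-≥two-terms f f≥0 x y x≢y =
    ℤP.≤-trans (ℤP.≤-reflexive (cong₂ _+_ (cong f (sym (fromFin-toFin x))) (cong f (sym (fromFin-toFin y)))))
               (sum-nonneg-≥two-terms _ (λ i → f≥0 (fromFin i)) (toFin x) (toFin y) (λ eq → x≢y (toFin-injective eq)))

  ∑G-nonneg-≡0 : (f : ℤ[G]) → (∀ x → 0ℤ ≤ f x) → ∑G f ≡ 0ℤ → ∀ x → f x ≡ 0ℤ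
  ∑G-nonneg-≡0 f f≥0 ∑f≡0 x =
    ℤP.≤-antisym (ℤP.≤-trans (∑G-nonneg-≥term f f≥0 x) (ℤP.≤-reflexive ∑f≡0)) (f≥0 x)

module GroupAlgebra (G : FiniteAbelianGroup) where

  open import Data.Integer as ℤ using (ℤ; +_; -_; _+_; _*_; 0ℤ; 1ℤ; _≤_)
  import Data.Integer.Properties as ℤP
  open import Data.Product using (_,_)
  open import Data.Sum using (inj₁; inj₂)
  open import Data.Empty using (⊥-elim)
  import Data.Maybe as Maybe
  open import Relation.Nullary using (Dec; yes; no)
  open import Relation.Nullary.Decidable using (dec⇒maybe)
  open import Relation.Binary.PropositionalEquality
  open import Algebra.Bundles using (CommutativeRing)
  open import Algebra.Structures using (IsCommutativeRing)
  import Algebra.Construct.Pointwise as Pointwise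
  open import Algebra.Solver.Ring.AlmostCommutativeRing using (fromCommutativeRing; _-Raw-AlmostCommutative⟶_)
  import Algebra.Solver.Ring as RingSolver
  open import Data.Integer.Solver using (module +-*-Solver)
  open IntegerFacts
  open Indicators
  open ListSums
  open GroupSums G public

  infixl 7 _⋆_
  infixl 6 _⊕_
  infix  4 _≈_

  _≈_ : ℤ[G] → ℤ[G] → Set
  f ≈ g = ∀ x → f x ≡ g x

  _⋆_ : ℤ[G] → ℤ[G] → ℤ[G]
  (f ⋆ g) a = ∑G (λ x → f x * g (x ⁻¹ ∙ a))

  _⊕_ : ℤ[G] → ℤ[G] → ℤ[G]
  (f ⊕ g) a = f a + g a

  ⊝_ : ℤ[G] → ℤ[G]
  (⊝ f) a = - f a

  𝟘 : ℤ[G]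
  𝟘 _ = 0ℤ

  𝕁 : ℤ[G]
  𝕁 _ = 1ℤ

  δ : Carrier → ℤ[G]
  δ b x = ⟦ x ≟ b ⟧

  δ-same : ∀ b → δ b b ≡ 1ℤ
  δ-same b = ⟦⟧-yes (b ≟ b) refl

  δ-diff : ∀ b x → x ≢ b → δ b x ≡ 0ℤ
  δ-diff b x = ⟦⟧-no (x ≟ b)

  ∑G-δ : ∀ b → ∑G (δ b) ≡ 1ℤ
  ∑G-δ b = trans (∑G-zero-except (δ b) b (δ-diff b)) (δ-same b)

  ι : ℤ → ℤ[G]
  ι c x = c * δ ε x

  reflect : ℤ[G] → ℤ[G]
  reflect f x = f (x ⁻¹)

  ⋆-cong : ∀ {f f′ g g′} → f ≈ f′ → g ≈ g′ → f ⋆ g ≈ f′ ⋆ g′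
  ⋆-cong f≈f′ g≈g′ a = ∑G-cong (λ x → cong₂ _*_ (f≈f′ x) (g≈g′ (x ⁻¹ ∙ a)))

  ⋆-comm : ∀ f g → f ⋆ g ≈ g ⋆ f
  ⋆-comm f g a = trans (∑G-reindex φ φ φ-involutive φ-involutive (λ x → f x * g (x ⁻¹ ∙ a)))
                       (∑G-cong (λ x → begin
                         f (a ∙ x ⁻¹) * g ((a ∙ x ⁻¹) ⁻¹ ∙ a) ≡⟨ cong (λ u → f (a ∙ x ⁻¹) * g u) ([x∙y⁻¹]⁻¹∙x≡y a x) ⟩
                         f (a ∙ x ⁻¹) * g x                   ≡⟨ ℤP.*-comm (f (a ∙ x ⁻¹)) (g x) ⟩
                         g x * f (a ∙ x ⁻¹)                   ≡⟨ cong (λ u → g x * f u) (comm a (x ⁻¹)) ⟩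
                         g x * f (x ⁻¹ ∙ a)                   ∎))
    where
    open ≡-Reasoning
    φ : Carrier → Carrier
    φ x = a ∙ x ⁻¹
    φ-involutive : ∀ x → φ (φ x) ≡ x
    φ-involutive x = trans (comm a _) ([x∙y⁻¹]⁻¹∙x≡y a x)

  ⋆-assoc : ∀ f g h → (f ⋆ g) ⋆ h ≈ f ⋆ (g ⋆ h)
  ⋆-assoc f g h a = begin
    ∑G (λ x → ∑G (λ y → f y * g (y ⁻¹ ∙ x)) * h (x ⁻¹ ∙ a))
      ≡⟨ ∑G-cong (λ x → sym (∑G-*ʳ (h (x ⁻¹ ∙ a)) (λ y → f y * g (y ⁻¹ ∙ x)))) ⟩
    ∑G (λ x → ∑G (λ y → f y * g (y ⁻¹ ∙ x) * h (x ⁻¹ ∙ a)))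
      ≡⟨ ∑G-comm (λ x y → f y * g (y ⁻¹ ∙ x) * h (x ⁻¹ ∙ a)) ⟩
    ∑G (λ y → ∑G (λ x → f y * g (y ⁻¹ ∙ x) * h (x ⁻¹ ∙ a)))
      ≡⟨ ∑G-cong (λ y → ∑G-reindex-translate y (λ x → f y * g (y ⁻¹ ∙ x) * h (x ⁻¹ ∙ a))) ⟩
    ∑G (λ y → ∑G (λ z → f y * g (y ⁻¹ ∙ (y ∙ z)) * h ((y ∙ z) ⁻¹ ∙ a)))
      ≡⟨ ∑G-cong (λ y → ∑G-cong (λ z →
           cong₂ (λ u w → f y * g u * h w) (x⁻¹∙[x∙y]≡y y z) ([x∙y]⁻¹∙z≡y⁻¹∙[x⁻¹∙z] y z a))) ⟩
    ∑G (λ y → ∑G (λ z → f y * g z * h (z ⁻¹ ∙ (y ⁻¹ ∙ a))))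
      ≡⟨ ∑G-cong (λ y → trans (∑G-cong (λ z → ℤP.*-assoc (f y) (g z) (h (z ⁻¹ ∙ (y ⁻¹ ∙ a)))))
                              (∑G-*ˡ (f y) (λ z → g z * h (z ⁻¹ ∙ (y ⁻¹ ∙ a))))) ⟩
    ∑G (λ y → f y * ∑G (λ z → g z * h (z ⁻¹ ∙ (y ⁻¹ ∙ a)))) ∎
    where open ≡-Reasoning

  ⋆-distribˡ : ∀ f g h → f ⋆ (g ⊕ h) ≈ f ⋆ g ⊕ f ⋆ h
  ⋆-distribˡ f g h a = trans (∑G-cong (λ x → ℤP.*-distribˡ-+ (f x) (g (x ⁻¹ ∙ a)) (h (x ⁻¹ ∙ a))))
                             (∑G-+ (λ x → f x * g (x ⁻¹ ∙ a)) (λ x → f x * h (x ⁻¹ ∙ a)))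

  ⋆-distribʳ : ∀ f g h → (g ⊕ h) ⋆ f ≈ g ⋆ f ⊕ h ⋆ f
  ⋆-distribʳ f g h a = trans (⋆-comm (g ⊕ h) f a)
                             (trans (⋆-distribˡ f g h a) (cong₂ _+_ (⋆-comm f g a) (⋆-comm f h a)))

  ι⋆f≈c*f : ∀ c f → ι c ⋆ f ≈ λ x → c * f x
  ι⋆f≈c*f c f a = trans (∑G-zero-except _ ε off-ε) (cong₂ _*_ ιc-at-ε (cong f (ε⁻¹∙x≡x a)))
    where
    off-ε : ∀ x → x ≢ ε → c * δ ε x * f (x ⁻¹ ∙ a) ≡ 0ℤ
    off-ε x x≢ε rewrite δ-diff ε x x≢ε | ℤP.*-zeroʳ c = ℤP.*-zeroˡ (f (x ⁻¹ ∙ a))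
    ιc-at-ε : c * δ ε ε ≡ c
    ιc-at-ε = trans (cong (c *_) (δ-same ε)) (ℤP.*-identityʳ c)

  ⋆-identityˡ : ∀ f → ι 1ℤ ⋆ f ≈ f
  ⋆-identityˡ f a = trans (ι⋆f≈c*f 1ℤ f a) (ℤP.*-identityˡ (f a))

  ⋆-identityʳ : ∀ f → f ⋆ ι 1ℤ ≈ f
  ⋆-identityʳ f a = trans (⋆-comm f (ι 1ℤ) a) (⋆-identityˡ f a)

  ι-⋆-homo : ∀ a b → ι a ⋆ ι b ≈ ι (a * b)
  ι-⋆-homo a b x = trans (ι⋆f≈c*f a (ι b) x) (sym (ℤP.*-assoc a b (δ ε x)))

  scalar-⋆ : ∀ {f} a g → f ≈ ι a → f ⋆ g ≈ (λ x → a * g x)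
  scalar-⋆ {f} a g f≈ιa x = trans (⋆-cong {f} {ι a} {g} {g} f≈ιa (λ _ → refl) x) (ι⋆f≈c*f a g x)

  ⋆ι-homo : ∀ {f} a b → f ≈ ι a → f ⋆ ι b ≈ ι (a * b)
  ⋆ι-homo {f} a b f≈ιa x = trans (⋆-cong {f} {ι a} {ι b} {ι b} f≈ιa (λ _ → refl) x) (ι-⋆-homo a b x)

  isCommutativeRing : IsCommutativeRing _≈_ _⊕_ _⋆_ ⊝_ 𝟘 (ι 1ℤ)
  isCommutativeRing = record
    { isRing = record
      { +-isAbelianGroup = Pointwise.isAbelianGroup Carrier ℤP.+-0-isAbelianGroup
      ; *-cong           = ⋆-cong
      ; *-assoc          = ⋆-assoc
      ; *-identity       = ⋆-identityˡ , ⋆-identityʳ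
      ; distrib          = ⋆-distribˡ , ⋆-distribʳ
      }
    ; *-comm = ⋆-comm
    }

  groupRing : CommutativeRing _ _
  groupRing = record { isCommutativeRing = isCommutativeRing }

  ι-homomorphism : CommutativeRing.rawRing ℤP.+-*-commutativeRing -Raw-AlmostCommutative⟶ fromCommutativeRing groupRing
  ι-homomorphism = record
    { ⟦_⟧    = ι
    ; +-homo = λ a b x → ℤP.*-distribʳ-+ (δ ε x) a b
    ; *-homo = λ a b x → sym (ι-⋆-homo a b x)
    ; -‿homo = λ a x → sym (ℤP.neg-distribˡ-* a (δ ε x))
    ; 0-homo = λ x → ℤP.*-zeroˡ (δ ε x)
    ; 1-homo = λ x → refl
    }

  module GroupRingSolver = RingSolver (CommutativeRing.rawRing ℤP.+-*-commutativeRing)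
    (fromCommutativeRing groupRing) ι-homomorphism
    (λ a b → Maybe.map (λ a≡b x → cong (_* δ ε x) a≡b) (dec⇒maybe (a ℤ.≟ b)))

  ⋆[X⊕⊝Y]≈𝟘 : ∀ Z {X Y} → X ≈ Y → Z ⋆ (X ⊕ ⊝ Y) ≈ 𝟘
  ⋆[X⊕⊝Y]≈𝟘 Z {X} {Y} X≈Y a = trans (∑G-cong term≡0) (trans (∑G-const 0ℤ) (ℤP.*-zeroʳ (+ order)))
    where
    term≡0 : ∀ x → Z x * (X (x ⁻¹ ∙ a) + - Y (x ⁻¹ ∙ a)) ≡ 0ℤ
    term≡0 x rewrite X≈Y (x ⁻¹ ∙ a) | ℤP.+-inverseʳ (Y (x ⁻¹ ∙ a)) = ℤP.*-zeroʳ (Z x)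

  ⊕-≈𝟘 : ∀ {A B} → A ≈ 𝟘 → B ≈ 𝟘 → A ⊕ B ≈ 𝟘
  ⊕-≈𝟘 A≈𝟘 B≈𝟘 x = cong₂ _+_ (A≈𝟘 x) (B≈𝟘 x)

  X⊕⊝Y≈𝟘⇒X≈Y : ∀ {X Y} → X ⊕ ⊝ Y ≈ 𝟘 → X ≈ Y
  X⊕⊝Y≈𝟘⇒X≈Y {X} {Y} X-Y≈𝟘 x = ℤP.i-j≡0⇒i≡j (X x) (Y x) (X-Y≈𝟘 x)

  𝟙 : Subset → ℤ[G]
  𝟙 S x = χ (S x)

  ‖_‖² : ℤ[G] → ℤ
  ‖ f ‖² = ∑G (λ x → f x * f x)

  ‖f‖²≡0⇒f≈𝟘 : ∀ f → ‖ f ‖² ≡ 0ℤ → f ≈ 𝟘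
  ‖f‖²≡0⇒f≈𝟘 f ‖f‖²≡0 x = i*i≡0⇒i≡0 (f x) (∑G-nonneg-≡0 _ (λ y → i*i≥0 (f y)) ‖f‖²≡0 x)

  ‖f‖²≤0⇒f≈𝟘 : ∀ f → ‖ f ‖² ≤ 0ℤ → f ≈ 𝟘
  ‖f‖²≤0⇒f≈𝟘 f ‖f‖²≤0 = ‖f‖²≡0⇒f≈𝟘 f (ℤP.≤-antisym ‖f‖²≤0 (∑G-nonneg _ (λ x → i*i≥0 (f x))))

  ⋆-at-ε : ∀ f g → (f ⋆ g) ε ≡ ∑G (λ x → f x * g (x ⁻¹))
  ⋆-at-ε f g = ∑G-cong (λ x → cong (λ u → f x * g u) (identityʳ (x ⁻¹)))

  reflect-⋆ : ∀ f g → reflect (f ⋆ g) ≈ reflect f ⋆ reflect g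
  reflect-⋆ f g a = trans (∑G-reindex-⁻¹ (λ x → f x * g (x ⁻¹ ∙ a ⁻¹)))
    (∑G-cong (λ x → cong (λ u → f (x ⁻¹) * g u) (⁻¹-∙-comm (x ⁻¹) a)))

  -- With σ = ±1, Z := Y ⋆ Y is reflection invariant, so Z ⋆ Z at ε is ‖Z‖² ≥ 0;
  -- but the cube relation makes it κ σ ‖Y‖² ≤ 0. Hence Z ≈ 𝟘, and Z ε = σ ‖Y‖² forces Y ≈ 𝟘.
  cube-eigenvector≈𝟘 : (Y : ℤ[G]) (σ κ : ℤ) → σ * σ ≡ 1ℤ → reflect Y ≈ (λ x → σ * Y x) →
                       Y ⋆ (Y ⋆ Y) ≈ (λ x → κ * Y x) → κ * σ ≤ 0ℤ → Y ≈ 𝟘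
  cube-eigenvector≈𝟘 Y σ κ σσ≡1 Y-sym Y³≈κY κσ≤0 = ‖f‖²≡0⇒f≈𝟘 Y ‖Y‖²≡0
    where
    open ≡-Reasoning
    Z : ℤ[G]
    Z = Y ⋆ Y

    Zε≡σ‖Y‖² : Z ε ≡ σ * ‖ Y ‖²
    Zε≡σ‖Y‖² = begin
      Z ε                           ≡⟨ ⋆-at-ε Y Y ⟩
      ∑G (λ x → Y x * Y (x ⁻¹))     ≡⟨ ∑G-cong (λ x → cong (Y x *_) (Y-sym x)) ⟩
      ∑G (λ x → Y x * (σ * Y x))    ≡⟨ ∑G-cong (λ x → solve 2 (λ y s → y :* (s :* y) := s :* (y :* y)) refl (Y x) σ) ⟩
      ∑G (λ x → σ * (Y x * Y x))    ≡⟨ ∑G-*ˡ σ (λ x → Y x * Y x) ⟩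
      σ * ‖ Y ‖²                    ∎
      where open +-*-Solver using (solve; _:*_; _:=_)

    Z-sym : reflect Z ≈ Z
    Z-sym x = begin
      reflect Z x                                   ≡⟨ reflect-⋆ Y Y x ⟩
      (reflect Y ⋆ reflect Y) x                     ≡⟨ ⋆-cong Y-sym Y-sym x ⟩
      ∑G (λ y → σ * Y y * (σ * Y (y ⁻¹ ∙ x)))
        ≡⟨ ∑G-cong (λ y → solve 3 (λ s u w → s :* u :* (s :* w) := (s :* s) :* (u :* w)) refl σ (Y y) (Y (y ⁻¹ ∙ x))) ⟩
      ∑G (λ y → σ * σ * (Y y * Y (y ⁻¹ ∙ x)))
        ≡⟨ ∑G-cong (λ y → cong (_* (Y y * Y (y ⁻¹ ∙ x))) σσ≡1) ⟩
      ∑G (λ y → 1ℤ * (Y y * Y (y ⁻¹ ∙ x)))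
        ≡⟨ ∑G-cong (λ y → ℤP.*-identityˡ (Y y * Y (y ⁻¹ ∙ x))) ⟩
      Z x                                           ∎
      where open +-*-Solver using (solve; _:*_; _:=_)

    [Z⋆Z]ε≡κσ‖Y‖² : (Z ⋆ Z) ε ≡ κ * σ * ‖ Y ‖²
    [Z⋆Z]ε≡κσ‖Y‖² = begin
      (Z ⋆ Z) ε                        ≡⟨ ⋆-assoc Y Y Z ε ⟩
      (Y ⋆ (Y ⋆ Z)) ε                  ≡⟨ ⋆-cong {Y} {Y} (λ _ → refl) Y³≈κY ε ⟩
      ∑G (λ x → Y x * (κ * Y (x ⁻¹ ∙ ε)))
        ≡⟨ ∑G-cong (λ x → solve 3 (λ y k w → y :* (k :* w) := k :* (y :* w)) refl (Y x) κ (Y (x ⁻¹ ∙ ε))) ⟩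
      ∑G (λ x → κ * (Y x * Y (x ⁻¹ ∙ ε))) ≡⟨ ∑G-*ˡ κ (λ x → Y x * Y (x ⁻¹ ∙ ε)) ⟩
      κ * Z ε                          ≡⟨ cong (κ *_) Zε≡σ‖Y‖² ⟩
      κ * (σ * ‖ Y ‖²)                 ≡⟨ sym (ℤP.*-assoc κ σ ‖ Y ‖²) ⟩
      κ * σ * ‖ Y ‖²                   ∎
      where open +-*-Solver using (solve; _:*_; _:=_)

    ‖Z‖²≤0 : ‖ Z ‖² ≤ 0ℤ
    ‖Z‖²≤0 = ℤP.≤-trans
      (ℤP.≤-reflexive (trans (∑G-cong (λ x → cong (Z x *_) (sym (Z-sym x)))) (trans (sym (⋆-at-ε Z Z)) [Z⋆Z]ε≡κσ‖Y‖²)))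
      (i≤0∧j≥0⇒i*j≤0 (κ * σ) ‖ Y ‖² κσ≤0 (∑G-nonneg _ (λ x → i*i≥0 (Y x))))

    ‖Y‖²≡0 : ‖ Y ‖² ≡ 0ℤ
    ‖Y‖²≡0 with ℤP.i*j≡0⇒i≡0∨j≡0 σ (trans (sym Zε≡σ‖Y‖²) (‖f‖²≤0⇒f≈𝟘 Z ‖Z‖²≤0 ε))
    ... | inj₂ ‖Y‖²≡0 = ‖Y‖²≡0
    ... | inj₁ σ≡0 = ⊥-elim (1≢0 (trans (sym σσ≡1) (trans (cong (_* σ) σ≡0) (ℤP.*-zeroˡ σ))))
      where
      1≢0 : 1ℤ ≢ 0ℤ
      1≢0 ()

  -- Each identity holds because the difference of its two sides is an explicit
  -- ℤ[G]-linear combination of the five hypotheses, checked by the ring solver.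
  module CubeRelations (S T M C K V : ℤ[G])
    (S⋆S≈M⋆𝕁⊕C : S ⋆ S ≈ M ⋆ 𝕁 ⊕ C) (T⋆T≈M⋆𝕁⊕C : T ⋆ T ≈ M ⋆ 𝕁 ⊕ C)
    (S⋆𝕁≈K⋆𝕁 : S ⋆ 𝕁 ≈ K ⋆ 𝕁) (T⋆𝕁≈K⋆𝕁 : T ⋆ 𝕁 ≈ K ⋆ 𝕁)
    (𝕁⋆𝕁≈V⋆𝕁 : 𝕁 ⋆ 𝕁 ≈ V ⋆ 𝕁) where
    open GroupRingSolver

    D P Q : ℤ[G]
    D = S ⊕ ⊝ T
    P = S ⊕ T
    Q = V ⋆ P ⊕ ⊝ (ι (+ 2) ⋆ K ⋆ 𝕁)

    D-cube : D ⋆ (D ⋆ D) ≈ ι (+ 4) ⋆ C ⋆ D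
    D-cube = X⊕⊝Y≈𝟘⇒X≈Y (λ x → trans (certificate x)
      (⊕-≈𝟘 (⊕-≈𝟘 (⊕-≈𝟘
        (⋆[X⊕⊝Y]≈𝟘 (ι (+ 2) ⋆ D ⊕ ⊝ P) S⋆S≈M⋆𝕁⊕C)
        (⋆[X⊕⊝Y]≈𝟘 (ι (+ 2) ⋆ D ⊕ P) T⋆T≈M⋆𝕁⊕C))
        (⋆[X⊕⊝Y]≈𝟘 (ι (+ 4) ⋆ M) S⋆𝕁≈K⋆𝕁))
        (⋆[X⊕⊝Y]≈𝟘 (⊝ (ι (+ 4) ⋆ M)) T⋆𝕁≈K⋆𝕁) x))
      where
      certificate : D ⋆ (D ⋆ D) ⊕ ⊝ (ι (+ 4) ⋆ C ⋆ D) ≈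
          (ι (+ 2) ⋆ D ⊕ ⊝ P) ⋆ (S ⋆ S ⊕ ⊝ (M ⋆ 𝕁 ⊕ C))
        ⊕ (ι (+ 2) ⋆ D ⊕ P) ⋆ (T ⋆ T ⊕ ⊝ (M ⋆ 𝕁 ⊕ C))
        ⊕ (ι (+ 4) ⋆ M) ⋆ (S ⋆ 𝕁 ⊕ ⊝ (K ⋆ 𝕁))
        ⊕ (⊝ (ι (+ 4) ⋆ M)) ⋆ (T ⋆ 𝕁 ⊕ ⊝ (K ⋆ 𝕁))
      certificate = solve 6 (λ S T J M C K →
        let D = S :- T ; P = S :+ T in
        D :* (D :* D) :- con (+ 4) :* C :* D :=
        (con (+ 2) :* D :- P) :* (S :* S :- (M :* J :+ C)) :+ (con (+ 2) :* D :+ P) :* (T :* T :- (M :* J :+ C))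
        :+ (con (+ 4) :* M) :* (S :* J :- K :* J) :+ (:- (con (+ 4) :* M)) :* (T :* J :- K :* J))
        (λ _ → refl) S T 𝕁 M C K

    Q-cube : Q ⋆ (Q ⋆ Q) ≈ ι (+ 4) ⋆ C ⋆ V ⋆ V ⋆ Q
    Q-cube = X⊕⊝Y≈𝟘⇒X≈Y (λ x → trans (certificate x)
      (⊕-≈𝟘 (⊕-≈𝟘 (⊕-≈𝟘 (⊕-≈𝟘
        (⋆[X⊕⊝Y]≈𝟘 Z₁ S⋆S≈M⋆𝕁⊕C)
        (⋆[X⊕⊝Y]≈𝟘 Z₂ T⋆T≈M⋆𝕁⊕C))
        (⋆[X⊕⊝Y]≈𝟘 Z₃ S⋆𝕁≈K⋆𝕁))
        (⋆[X⊕⊝Y]≈𝟘 Z₄ T⋆𝕁≈K⋆𝕁))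
        (⋆[X⊕⊝Y]≈𝟘 Z₅ 𝕁⋆𝕁≈V⋆𝕁) x))
      where
      W Z₁ Z₂ Z₃ Z₄ Z₅ : ℤ[G]
      W  = ι (+ 4) ⋆ M ⋆ V ⋆ V ⊕ ⊝ (ι (+ 4) ⋆ V ⋆ K ⋆ P) ⊕ ι (+ 4) ⋆ K ⋆ K ⋆ 𝕁
      Z₁ = ι (+ 2) ⋆ V ⋆ V ⋆ Q ⊕ ⊝ (V ⋆ V ⋆ V ⋆ D)
      Z₂ = ι (+ 2) ⋆ V ⋆ V ⋆ Q ⊕ V ⋆ V ⋆ V ⋆ D
      Z₃ = W ⋆ V ⊕ ι (+ 2) ⋆ K ⋆ V ⋆ V ⋆ D
      Z₄ = W ⋆ V ⊕ ⊝ (ι (+ 2) ⋆ K ⋆ V ⋆ V ⋆ D)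
      Z₅ = ⊝ (ι (+ 2) ⋆ K ⋆ W)
      certificate : Q ⋆ (Q ⋆ Q) ⊕ ⊝ (ι (+ 4) ⋆ C ⋆ V ⋆ V ⋆ Q) ≈
          Z₁ ⋆ (S ⋆ S ⊕ ⊝ (M ⋆ 𝕁 ⊕ C)) ⊕ Z₂ ⋆ (T ⋆ T ⊕ ⊝ (M ⋆ 𝕁 ⊕ C))
        ⊕ Z₃ ⋆ (S ⋆ 𝕁 ⊕ ⊝ (K ⋆ 𝕁)) ⊕ Z₄ ⋆ (T ⋆ 𝕁 ⊕ ⊝ (K ⋆ 𝕁))
        ⊕ Z₅ ⋆ (𝕁 ⋆ 𝕁 ⊕ ⊝ (V ⋆ 𝕁))
      certificate = solve 7 (λ S T J M C K V →
        let D = S :- T ; P = S :+ T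
            Q = V :* P :- con (+ 2) :* K :* J
            W = con (+ 4) :* M :* V :* V :- con (+ 4) :* V :* K :* P :+ con (+ 4) :* K :* K :* J
            Z₁ = con (+ 2) :* V :* V :* Q :- V :* V :* V :* D
            Z₂ = con (+ 2) :* V :* V :* Q :+ V :* V :* V :* D
            Z₃ = W :* V :+ con (+ 2) :* K :* V :* V :* D
            Z₄ = W :* V :- con (+ 2) :* K :* V :* V :* D
            Z₅ = :- (con (+ 2) :* K :* W)
        in
        Q :* (Q :* Q) :- con (+ 4) :* C :* V :* V :* Q :=
        Z₁ :* (S :* S :- (M :* J :+ C)) :+ Z₂ :* (T :* T :- (M :* J :+ C))
        :+ Z₃ :* (S :* J :- K :* J) :+ Z₄ :* (T :* J :- K :* J) :+ Z₅ :* (J :* J :- V :* J))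
        (λ _ → refl) S T 𝕁 M C K V

  ∑G-⋆ : ∀ f g → ∑G (f ⋆ g) ≡ ∑G f * ∑G g
  ∑G-⋆ f g = begin
    ∑G (λ a → ∑G (λ x → f x * g (x ⁻¹ ∙ a)))  ≡⟨ ∑G-comm (λ a x → f x * g (x ⁻¹ ∙ a)) ⟩
    ∑G (λ x → ∑G (λ a → f x * g (x ⁻¹ ∙ a)))  ≡⟨ ∑G-cong (λ x → ∑G-*ˡ (f x) (λ a → g (x ⁻¹ ∙ a))) ⟩
    ∑G (λ x → f x * ∑G (λ a → g (x ⁻¹ ∙ a)))
      ≡⟨ ∑G-cong (λ x → cong (f x *_) (sym (∑G-reindex-translate (x ⁻¹) g))) ⟩
    ∑G (λ x → f x * ∑G g)                     ≡⟨ ∑G-*ʳ (∑G g) f ⟩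
    ∑G f * ∑G g                               ∎
    where open ≡-Reasoning

  δε-reflect : ∀ x → δ ε (x ⁻¹) ≡ δ ε x
  δε-reflect x with (x ⁻¹) ≟ ε | x ≟ ε
  ... | yes _ | yes _ = refl
  ... | no _  | no _  = refl
  ... | yes x⁻¹≡ε | no x≢ε  = ⊥-elim (x≢ε (trans (sym (⁻¹-involutive x)) (trans (cong _⁻¹ x⁻¹≡ε) ε⁻¹≈ε)))
  ... | no x⁻¹≢ε  | yes x≡ε = ⊥-elim (x⁻¹≢ε (trans (cong _⁻¹ x≡ε) ε⁻¹≈ε))

  f⋆𝕁≈ι∑f⋆𝕁 : ∀ f → f ⋆ 𝕁 ≈ ι (∑G f) ⋆ 𝕁
  f⋆𝕁≈ι∑f⋆𝕁 f a = begin
    ∑G (λ x → f x * 1ℤ) ≡⟨ ∑G-cong (λ x → ℤP.*-identityʳ (f x)) ⟩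
    ∑G f                ≡⟨ sym (ℤP.*-identityʳ (∑G f)) ⟩
    ∑G f * 1ℤ           ≡⟨ sym (ι⋆f≈c*f (∑G f) 𝕁 a) ⟩
    (ι (∑G f) ⋆ 𝕁) a    ∎
    where open ≡-Reasoning

module PairCounts (G : FiniteAbelianGroup) where

  open import Data.Integer using (ℤ; +_; _*_; 0ℤ; 1ℤ)
  import Data.Integer.Properties as ℤP
  open import Data.Bool as Bool using (true)
  open import Data.List using (allFin; length; filter; cartesianProduct)
  open import Data.Product using (_×_; _,_; proj₁; proj₂)
  open import Relation.Nullary using (Dec)
  open import Relation.Binary.PropositionalEquality
  open import Data.Integer.Solver using (module +-*-Solver)
  open Indicators
  open ListSums
  open GroupAlgebra G

  lsum-elements : (w : ℤ[G]) → lsum w elements ≡ ∑G w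
  lsum-elements w = trans (lsum-map w fromFin (allFin order)) (lsum-tabulate (λ x → w (fromFin x)) (λ i → i))

  +#pairs≡∑∑ : ∀ (S : Subset) (F : Carrier → Carrier → Carrier) a →
    + length (filter (λ p → F (proj₁ p) (proj₂ p) ≟ a) (pairsIn S)) ≡
    ∑G (λ x → ∑G (λ y → 𝟙 S x * 𝟙 S y * ⟦ F x y ≟ a ⟧))
  +#pairs≡∑∑ S F a = begin
    + length (filter F≟a (pairsIn S))
      ≡⟨ length≡lsum-1 (filter F≟a (pairsIn S)) ⟩
    lsum (λ _ → 1ℤ) (filter F≟a (pairsIn S))
      ≡⟨ lsum-filter F≟a (λ _ → 1ℤ) (pairsIn S) ⟩
    lsum w₁ (pairsIn S)
      ≡⟨ lsum-filter S₁? w₁ (filter S₂? (cartesianProduct elements elements)) ⟩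
    lsum w₂ (filter S₂? (cartesianProduct elements elements))
      ≡⟨ lsum-filter S₂? w₂ (cartesianProduct elements elements) ⟩
    lsum w₃ (cartesianProduct elements elements)
      ≡⟨ lsum-cartesianProduct w₃ elements elements ⟩
    lsum (λ x → lsum (λ y → w₃ (x , y)) elements) elements
      ≡⟨ trans (lsum-cong (λ x → lsum-elements (λ y → w₃ (x , y))) elements) (lsum-elements _) ⟩
    ∑G (λ x → ∑G (λ y → w₃ (x , y)))
      ≡⟨ ∑G-cong (λ x → ∑G-cong (λ y → normalise x y)) ⟩
    ∑G (λ x → ∑G (λ y → 𝟙 S x * 𝟙 S y * ⟦ F x y ≟ a ⟧)) ∎
    where
    open ≡-Reasoning
    F≟a S₁? S₂? : (p : Carrier × Carrier) → Dec _
    F≟a p = F (proj₁ p) (proj₂ p) ≟ a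
    S₁? p = S (proj₁ p) Bool.≟ true
    S₂? p = S (proj₂ p) Bool.≟ true
    w₁ w₂ w₃ : Carrier × Carrier → ℤ
    w₁ p = ⟦ F≟a p ⟧ * 1ℤ
    w₂ p = ⟦ S₁? p ⟧ * w₁ p
    w₃ p = ⟦ S₂? p ⟧ * w₂ p
    normalise : ∀ x y → w₃ (x , y) ≡ 𝟙 S x * 𝟙 S y * ⟦ F x y ≟ a ⟧
    normalise x y rewrite ⟦b≟true⟧≡χb (S x) | ⟦b≟true⟧≡χb (S y) =
      solve 3 (λ u w d → w :* (u :* (d :* con 1ℤ)) := u :* w :* d) refl (𝟙 S x) (𝟙 S y) ⟦ F x y ≟ a ⟧
      where open +-*-Solver using (solve; _:*_; _:=_; con)

  ∑-pairs-with-unique-partner : ∀ (S : Subset) (F : Carrier → Carrier → Carrier) a x b →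
    (∀ y → F x y ≡ a → y ≡ b) → F x b ≡ a →
    ∑G (λ y → 𝟙 S x * 𝟙 S y * ⟦ F x y ≟ a ⟧) ≡ 𝟙 S x * 𝟙 S b
  ∑-pairs-with-unique-partner S F a x b unique F[x,b]≡a =
    trans (∑G-zero-except _ b off-b) at-b
    where
    off-b : ∀ y → y ≢ b → 𝟙 S x * 𝟙 S y * ⟦ F x y ≟ a ⟧ ≡ 0ℤ
    off-b y y≢b rewrite ⟦⟧-no (F x y ≟ a) (λ F[x,y]≡a → y≢b (unique y F[x,y]≡a)) = ℤP.*-zeroʳ (𝟙 S x * 𝟙 S y)
    at-b : 𝟙 S x * 𝟙 S b * ⟦ F x b ≟ a ⟧ ≡ 𝟙 S x * 𝟙 S b
    at-b rewrite ⟦⟧-yes (F x b ≟ a) F[x,b]≡a = ℤP.*-identityʳ (𝟙 S x * 𝟙 S b)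

  +#products≡𝟙S⋆𝟙S : ∀ S a → + #products S a ≡ (𝟙 S ⋆ 𝟙 S) a
  +#products≡𝟙S⋆𝟙S S a = trans (+#pairs≡∑∑ S _∙_ a) (∑G-cong (λ x →
    ∑-pairs-with-unique-partner S _∙_ a x (x ⁻¹ ∙ a)
      (λ y x∙y≡a → trans (sym (x⁻¹∙[x∙y]≡y x y)) (cong (x ⁻¹ ∙_) x∙y≡a))
      (x∙[x⁻¹∙y]≡y x a)))

  +#quotients≡𝟙S⋆reflect𝟙S : ∀ S a → + #quotients S a ≡ (𝟙 S ⋆ reflect (𝟙 S)) a
  +#quotients≡𝟙S⋆reflect𝟙S S a = trans (+#pairs≡∑∑ S (λ x y → x ∙ y ⁻¹) a) (∑G-cong (λ x →
    ∑-pairs-with-unique-partner S (λ x y → x ∙ y ⁻¹) a x ((x ⁻¹ ∙ a) ⁻¹)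
      (λ y x∙y⁻¹≡a → trans (sym (⁻¹-involutive y))
                       (cong _⁻¹ (trans (sym (x⁻¹∙[x∙y]≡y x (y ⁻¹))) (cong (x ⁻¹ ∙_) x∙y⁻¹≡a))))
      (trans (cong (x ∙_) (⁻¹-involutive _)) (x∙[x⁻¹∙y]≡y x a))))

module Fibres (G : FiniteAbelianGroup) where

  open import Data.Nat as ℕ using ()
  open import Data.Integer as ℤ using (ℤ; +_; -_; _+_; _*_; _-_; 0ℤ; 1ℤ; _≤_)
  import Data.Integer.Properties as ℤP
  open import Data.Product using (Σ; _,_)
  open import Data.Empty using (⊥-elim)
  open import Relation.Nullary using (¬_; yes; no)
  open import Relation.Binary.PropositionalEquality
  open import Data.Integer.Solver using (module +-*-Solver)
  open IntegerFacts using (i≥0∧i≢0⇒i≥1)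
  open Indicators
  open GroupAlgebra G

  module _ (φ : Carrier → Carrier) where

    #fibre : ℤ[G]
    #fibre h = ∑G (λ x → ⟦ φ x ≟ h ⟧)

    #fibre≥0 : ∀ h → 0ℤ ≤ #fibre h
    #fibre≥0 h = ∑G-nonneg _ (λ x → ⟦⟧≥0 (φ x ≟ h))

    ∑#fibre≡order : ∑G #fibre ≡ + order
    ∑#fibre≡order = begin
      ∑G (λ h → ∑G (λ x → ⟦ φ x ≟ h ⟧))  ≡⟨ ∑G-comm (λ h x → ⟦ φ x ≟ h ⟧) ⟩
      ∑G (λ x → ∑G (λ h → ⟦ φ x ≟ h ⟧))  ≡⟨ ∑G-cong (λ x → ∑G-zero-except _ (φ x) (off x)) ⟩
      ∑G (λ x → ⟦ φ x ≟ φ x ⟧)           ≡⟨ ∑G-cong (λ x → ⟦⟧-yes (φ x ≟ φ x) refl) ⟩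
      ∑G (λ _ → 1ℤ)                      ≡⟨ ∑G-const 1ℤ ⟩
      + order * 1ℤ                       ≡⟨ ℤP.*-identityʳ (+ order) ⟩
      + order                            ∎
      where
      open ≡-Reasoning
      off : ∀ x h → h ≢ φ x → ⟦ φ x ≟ h ⟧ ≡ 0ℤ
      off x h h≢φx = ⟦⟧-no (φ x ≟ h) (λ φx≡h → h≢φx (sym φx≡h))

    -- The fibre sizes sum to |G| and are ≥ 1 on a surjection, so a fibre of size ≥ 2 is impossible.
    nonInjective⇒nonSurjective : ∀ a b → a ≢ b → φ a ≡ φ b → Σ Carrier λ h → ∀ x → φ x ≢ h
    nonInjective⇒nonSurjective a b a≢b φa≡φb with any?G (λ h → #fibre h ℤ.≟ 0ℤ)
    ... | yes (h , #fibre≡0) = h , λ x φx≡h →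
      1≢0 (trans (sym (⟦⟧-yes (φ x ≟ h) φx≡h)) (∑G-nonneg-≡0 _ (λ y → ⟦⟧≥0 (φ y ≟ h)) #fibre≡0 x))
      where
      1≢0 : 1ℤ ≢ 0ℤ
      1≢0 ()
    ... | no ∄empty = ⊥-elim (2≰1 (ℤP.≤-trans two-in-fibre (ℤP.≤-reflexive #fibre[φa]≡1)))
      where
      excess : ℤ[G]
      excess h = #fibre h - 1ℤ
      excess≥0 : ∀ h → 0ℤ ≤ excess h
      excess≥0 h = ℤP.i≤j⇒0≤j-i (i≥0∧i≢0⇒i≥1 (#fibre h) (#fibre≥0 h) (λ #fibre≡0 → ∄empty (h , #fibre≡0)))
      ∑excess≡0 : ∑G excess ≡ 0ℤ
      ∑excess≡0 = begin
        ∑G (λ h → #fibre h + - 1ℤ)     ≡⟨ ∑G-+ #fibre (λ _ → - 1ℤ) ⟩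
        ∑G #fibre + ∑G (λ _ → - 1ℤ)    ≡⟨ cong₂ _+_ ∑#fibre≡order (∑G-const (- 1ℤ)) ⟩
        + order + + order * - 1ℤ       ≡⟨ solve 1 (λ v → v :+ v :* con (- 1ℤ) := con 0ℤ) refl (+ order) ⟩
        0ℤ                             ∎
        where
        open ≡-Reasoning
        open +-*-Solver using (solve; _:=_; _:+_; _:*_; con)
      #fibre[φa]≡1 : #fibre (φ a) ≡ 1ℤ
      #fibre[φa]≡1 = ℤP.i-j≡0⇒i≡j _ _ (∑G-nonneg-≡0 excess excess≥0 ∑excess≡0 (φ a))
      two-in-fibre : 1ℤ + 1ℤ ≤ #fibre (φ a)
      two-in-fibre = ℤP.≤-trans
        (ℤP.≤-reflexive (sym (cong₂ _+_ (⟦⟧-yes (φ a ≟ φ a) refl) (⟦⟧-yes (φ b ≟ φ a) (sym φa≡φb)))))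
        (∑G-nonneg-≥two-terms _ (λ x → ⟦⟧≥0 (φ x ≟ φ a)) a b a≢b)
      2≰1 : ¬ (1ℤ + 1ℤ ≤ 1ℤ)
      2≰1 (ℤ.+≤+ (ℕ.s≤s ()))

module TrivialSubsets (G : FiniteAbelianGroup) where

  open import Data.Nat as ℕ using ()
  open import Data.Integer as ℤ using (ℤ; +_; -_; _+_; _-_; 1ℤ; _≤_)
  import Data.Integer.Properties as ℤP
  open import Data.Bool using (Bool; true; false; not)
  open import Data.Bool.Properties using (not-¬; not-involutive)
  open import Data.Empty using (⊥-elim)
  open import Data.Product using (_,_)
  open import Data.Sum using (inj₁; inj₂)
  open import Relation.Nullary using (yes; no; ¬?)
  open import Relation.Nullary.Decidable using (decidable-stable)
  open import Relation.Binary.PropositionalEquality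
  open import Data.Integer.Solver using (module +-*-Solver)
  open Indicators
  open GroupAlgebra G

  module _ (S : Subset) where

    constant⇒trivial : ∀ g → (∀ x → S x ≡ S g) → IsTrivial S
    constant⇒trivial g S-const with S g
    ... | true  = inj₂ (inj₁ S-const)
    ... | false = inj₁ S-const

    value-only-at : ∀ g b → (∀ z → z ≢ g → S z ≡ not b) → ∀ x → S x ≡ b → x ≡ g
    value-only-at g b others x Sx≡b with x ≟ g
    ... | yes x≡g = x≡g
    ... | no x≢g  = ⊥-elim (not-¬ refl (trans (sym Sx≡b) (others x x≢g)))

    singleton⇒trivial : ∀ g → g ∙ g ≡ ε → S g ≡ true → (∀ z → z ≢ g → S z ≡ false) → IsTrivial S
    singleton⇒trivial g g²≡ε Sg others =
      inj₂ (inj₂ (inj₁ (g , g²≡ε , λ x → value-only-at g true others x , λ x≡g → trans (cong S x≡g) Sg)))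

    cosingleton⇒trivial : ∀ g → g ∙ g ≡ ε → S g ≡ false → (∀ z → z ≢ g → S z ≡ true) → IsTrivial S
    cosingleton⇒trivial g g²≡ε Sg others =
      inj₂ (inj₂ (inj₂ (g , g²≡ε , λ x → value-only-at g false others x , λ x≡g → trans (cong S x≡g) Sg)))

    module _ (g : Carrier) (g²≡ε : g ∙ g ≡ ε) (S-const : ∀ a b → a ≢ g → b ≢ g → S a ≡ S b) where

      constant-if-agrees-off : ∀ a → a ≢ g → S g ≡ S a → ∀ x → S x ≡ S g
      constant-if-agrees-off a a≢g Sg≡Sa x with x ≟ g
      ... | yes x≡g = cong S x≡g
      ... | no x≢g  = trans (S-const x a x≢g a≢g) (sym Sg≡Sa)

      constant-off⇒trivial : IsTrivial S
      constant-off⇒trivial with any?G (λ a → ¬? (a ≟ g))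
      ... | no ∄a≢g = constant⇒trivial g (λ x → cong S (decidable-stable (x ≟ g) (λ x≢g → ∄a≢g (x , x≢g))))
      ... | yes (a , a≢g) with S g in Sg | S a in Sa
      ...   | true  | false = singleton⇒trivial g g²≡ε Sg (λ z z≢g → trans (S-const z a z≢g a≢g) Sa)
      ...   | false | true  = cosingleton⇒trivial g g²≡ε Sg (λ z z≢g → trans (S-const z a z≢g a≢g) Sa)
      ...   | true  | true  = constant⇒trivial g (constant-if-agrees-off a a≢g (trans Sg (sym Sa)))
      ...   | false | false = constant⇒trivial g (constant-if-agrees-off a a≢g (trans Sg (sym Sa)))

  ∑𝟙≡1⇒singleton : ∀ S → ∑G (𝟙 S) ≡ 1ℤ → ∀ g → S g ≡ true → ∀ z → z ≢ g → S z ≡ false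
  ∑𝟙≡1⇒singleton S ∑𝟙S≡1 g Sg z z≢g = χ+1≤1⇒false (S z) (begin
    χ (S z) + 1ℤ       ≡⟨ cong (λ b → χ (S z) + χ b) (sym Sg) ⟩
    𝟙 S z + 𝟙 S g      ≤⟨ ∑G-nonneg-≥two-terms (𝟙 S) (λ x → χ≥0 (S x)) z g z≢g ⟩
    ∑G (𝟙 S)           ≡⟨ ∑𝟙S≡1 ⟩
    1ℤ                 ∎)
    where
    open ℤP.≤-Reasoning
    χ+1≤1⇒false : ∀ b → χ b + 1ℤ ≤ 1ℤ → b ≡ false
    χ+1≤1⇒false false _ = refl
    χ+1≤1⇒false true (ℤ.+≤+ (ℕ.s≤s ()))

  ∑𝟙+1≡order⇒cosingleton : ∀ S → ∑G (𝟙 S) + 1ℤ ≡ + order →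
                           ∀ g → S g ≡ false → ∀ z → z ≢ g → S z ≡ true
  ∑𝟙+1≡order⇒cosingleton S ∑𝟙S+1≡v g Sg z z≢g =
    trans (sym (not-involutive (S z))) (cong not (∑𝟙≡1⇒singleton S′ ∑𝟙S′≡1 g (cong not Sg) z z≢g))
    where
    S′ : Subset
    S′ x = not (S x)
    ∑𝟙S′≡1 : ∑G (𝟙 S′) ≡ 1ℤ
    ∑𝟙S′≡1 = begin
      ∑G (λ x → χ (not (S x)))         ≡⟨ ∑G-cong (λ x → χ-not (S x)) ⟩
      ∑G (λ x → 1ℤ + - 𝟙 S x)          ≡⟨ ∑G-+ (λ _ → 1ℤ) (λ x → - 𝟙 S x) ⟩
      ∑G (λ _ → 1ℤ) + ∑G (λ x → - 𝟙 S x)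
        ≡⟨ cong₂ _+_ (trans (∑G-const 1ℤ) (ℤP.*-identityʳ (+ order))) (∑G-neg (𝟙 S)) ⟩
      + order - ∑G (𝟙 S)               ≡⟨ cong (_- ∑G (𝟙 S)) (sym ∑𝟙S+1≡v) ⟩
      ∑G (𝟙 S) + 1ℤ - ∑G (𝟙 S)         ≡⟨ solve 1 (λ k → k :+ con 1ℤ :- k := con 1ℤ) refl (∑G (𝟙 S)) ⟩
      1ℤ                               ∎
      where
      open ≡-Reasoning
      open +-*-Solver using (solve; _:=_; _:+_; _:-_; con)

module SumSetSymmetry (G : FiniteAbelianGroup) where

  open import Data.Nat as ℕ using (ℕ)
  open import Data.Integer as ℤ using (ℤ; +_; -_; _+_; _*_; _-_; 0ℤ; 1ℤ; -1ℤ; _≤_)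
  import Data.Integer.Properties as ℤP
  open import Data.Product using (_,_; proj₁; proj₂)
  open import Data.Sum using (inj₁; inj₂)
  open import Relation.Nullary using (Dec; yes; no)
  open import Relation.Binary.PropositionalEquality
  open import Data.Integer.Solver using (module +-*-Solver)
  open IntegerFacts
  open Indicators using (χ; χ-injective; χa+χb≡χe+χe⇒a≡e)
  open GroupAlgebra G
  open PairCounts G

  module SumSet (S : Subset) (sumSet : IsSumSet S) where

    μ : ℕ
    μ = proj₁ sumSet

    s t : ℤ[G]
    s = 𝟙 S
    t = reflect s

    k v m c : ℤ
    k = ∑G s
    v = + order
    m = + μ
    c = (s ⋆ s) ε - m

    m𝕁⊕cδ : ℤ[G]
    m𝕁⊕cδ = ι m ⋆ 𝕁 ⊕ ι c

    m𝕁⊕cδ-value : ∀ a → m𝕁⊕cδ a ≡ m + c * δ ε a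
    m𝕁⊕cδ-value a = cong (_+ c * δ ε a) (trans (ι⋆f≈c*f m 𝕁 a) (ℤP.*-identityʳ m))

    s⋆s≈m𝕁⊕cδ : s ⋆ s ≈ m𝕁⊕cδ
    s⋆s≈m𝕁⊕cδ a = trans (at a (a ≟ ε)) (sym (m𝕁⊕cδ-value a))
      where
      at : ∀ a → Dec (a ≡ ε) → (s ⋆ s) a ≡ m + c * δ ε a
      at a (yes refl) rewrite δ-same ε | ℤP.*-identityʳ c =
        solve 2 (λ σ m → σ := m :+ (σ :- m)) refl ((s ⋆ s) ε) m
        where open +-*-Solver using (solve; _:=_; _:+_; _:-_)
      at a (no a≢ε) rewrite δ-diff ε a a≢ε | ℤP.*-zeroʳ c | ℤP.+-identityʳ m =
        trans (sym (+#products≡𝟙S⋆𝟙S S a)) (cong +_ (proj₂ sumSet a a≢ε))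

    t⋆t≈m𝕁⊕cδ : t ⋆ t ≈ m𝕁⊕cδ
    t⋆t≈m𝕁⊕cδ a = begin
      (t ⋆ t) a               ≡⟨ sym (reflect-⋆ s s a) ⟩
      (s ⋆ s) (a ⁻¹)          ≡⟨ s⋆s≈m𝕁⊕cδ (a ⁻¹) ⟩
      m𝕁⊕cδ (a ⁻¹)            ≡⟨ m𝕁⊕cδ-value (a ⁻¹) ⟩
      m + c * δ ε (a ⁻¹)      ≡⟨ cong (λ z → m + c * z) (δε-reflect a) ⟩
      m + c * δ ε a           ≡⟨ sym (m𝕁⊕cδ-value a) ⟩
      m𝕁⊕cδ a                 ∎
      where open ≡-Reasoning

    ∑t≡k : ∑G t ≡ k
    ∑t≡k = sym (∑G-reindex-⁻¹ s)

    s⋆𝕁≈ιk⋆𝕁 : s ⋆ 𝕁 ≈ ι k ⋆ 𝕁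
    s⋆𝕁≈ιk⋆𝕁 = f⋆𝕁≈ι∑f⋆𝕁 s

    t⋆𝕁≈ιk⋆𝕁 : t ⋆ 𝕁 ≈ ι k ⋆ 𝕁
    t⋆𝕁≈ιk⋆𝕁 a = trans (f⋆𝕁≈ι∑f⋆𝕁 t a) (cong (λ z → (ι z ⋆ 𝕁) a) ∑t≡k)

    𝕁⋆𝕁≈ιv⋆𝕁 : 𝕁 ⋆ 𝕁 ≈ ι v ⋆ 𝕁
    𝕁⋆𝕁≈ιv⋆𝕁 a = trans (f⋆𝕁≈ι∑f⋆𝕁 𝕁 a)
                       (cong (λ z → (ι z ⋆ 𝕁) a) (trans (∑G-const 1ℤ) (ℤP.*-identityʳ v)))

    open CubeRelations s t (ι m) (ι c) (ι k) (ι v)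
      s⋆s≈m𝕁⊕cδ t⋆t≈m𝕁⊕cδ s⋆𝕁≈ιk⋆𝕁 t⋆𝕁≈ιk⋆𝕁 𝕁⋆𝕁≈ιv⋆𝕁

    D³≈4cD : D ⋆ (D ⋆ D) ≈ (λ x → + 4 * c * D x)
    D³≈4cD x = trans (D-cube x) (scalar-⋆ (+ 4 * c) D (ι-⋆-homo (+ 4) c) x)

    Q³≈4cv²Q : Q ⋆ (Q ⋆ Q) ≈ (λ x → + 4 * c * v * v * Q x)
    Q³≈4cv²Q x = trans (Q-cube x)
      (scalar-⋆ (+ 4 * c * v * v) Q (⋆ι-homo (+ 4 * c * v) v (⋆ι-homo (+ 4 * c) v (ι-⋆-homo (+ 4) c))) x)

    reflect-D : reflect D ≈ (λ x → -1ℤ * D x)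
    reflect-D x rewrite ⁻¹-involutive x =
      solve 2 (λ a b → b :- a := con -1ℤ :* (a :- b)) refl (s x) (s (x ⁻¹))
      where open +-*-Solver using (solve; _:=_; _:-_; _:*_; con)

    c≥0⇒symmetric : 0ℤ ≤ c → IsSymmetric S
    c≥0⇒symmetric c≥0 x = χ-injective _ _ (sym (ℤP.i-j≡0⇒i≡j (s x) (s (x ⁻¹)) (D≈𝟘 x)))
      where
      κσ≤0 : + 4 * c * -1ℤ ≤ 0ℤ
      κσ≤0 = ℤP.≤-trans (ℤP.≤-reflexive (solve 1 (λ c → con (+ 4) :* c :* con -1ℤ := con (- + 4) :* c) refl c))
                        (i≤0∧j≥0⇒i*j≤0 (- + 4) c ℤ.-≤+ c≥0)
        where open +-*-Solver using (solve; _:=_; _:*_; con)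
      D≈𝟘 : D ≈ 𝟘
      D≈𝟘 = cube-eigenvector≈𝟘 D -1ℤ (+ 4 * c) refl reflect-D D³≈4cD κσ≤0

    Q-value : ∀ x → Q x ≡ v * (s x + t x) - + 2 * k * 1ℤ
    Q-value x = cong₂ _-_ (ι⋆f≈c*f v P x) (scalar-⋆ (+ 2 * k) 𝕁 (ι-⋆-homo (+ 2) k) x)

    reflect-Q : reflect Q ≈ (λ x → 1ℤ * Q x)
    reflect-Q x = begin
      Q (x ⁻¹)                                     ≡⟨ Q-value (x ⁻¹) ⟩
      v * (s (x ⁻¹) + s (x ⁻¹ ⁻¹)) - + 2 * k * 1ℤ  ≡⟨ cong (λ u → v * (s (x ⁻¹) + s u) - + 2 * k * 1ℤ) (⁻¹-involutive x) ⟩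
      v * (s (x ⁻¹) + s x) - + 2 * k * 1ℤ          ≡⟨ cong (λ u → v * u - + 2 * k * 1ℤ) (ℤP.+-comm (s (x ⁻¹)) (s x)) ⟩
      v * (s x + t x) - + 2 * k * 1ℤ               ≡⟨ sym (Q-value x) ⟩
      Q x                                          ≡⟨ sym (ℤP.*-identityˡ (Q x)) ⟩
      1ℤ * Q x                                     ∎
      where open ≡-Reasoning

    c≤0⇒constant : c ≤ 0ℤ → ∀ x → S x ≡ S ε
    c≤0⇒constant c≤0 x = χa+χb≡χe+χe⇒a≡e (S x) (S (x ⁻¹)) (S ε)
      (ℤP.*-cancelˡ-≡ v _ _ {{ℕ.≢-nonZero order≢0}} (begin
        v * (s x + t x)  ≡⟨ v[s+t]≡2k x ⟩
        + 2 * k * 1ℤ     ≡⟨ sym (v[s+t]≡2k ε) ⟩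
        v * (s ε + t ε)  ≡⟨ cong (λ u → v * (s ε + s u)) ε⁻¹≈ε ⟩
        v * (s ε + s ε)  ∎))
      where
      open ≡-Reasoning
      κσ≤0 : + 4 * c * v * v * 1ℤ ≤ 0ℤ
      κσ≤0 = ℤP.≤-trans
        (ℤP.≤-reflexive (solve 2 (λ c v → con (+ 4) :* c :* v :* v :* con 1ℤ := c :* (con (+ 4) :* (v :* v))) refl c v))
        (i≤0∧j≥0⇒i*j≤0 c (+ 4 * (v * v)) c≤0 (ℤP.*-monoˡ-≤-nonNeg (+ 4) (i*i≥0 v)))
        where open +-*-Solver using (solve; _:=_; _:*_; con)
      Q≈𝟘 : Q ≈ 𝟘
      Q≈𝟘 = cube-eigenvector≈𝟘 Q 1ℤ (+ 4 * c * v * v) refl reflect-Q Q³≈4cv²Q κσ≤0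
      v[s+t]≡2k : ∀ x → v * (s x + t x) ≡ + 2 * k * 1ℤ
      v[s+t]≡2k x = ℤP.i-j≡0⇒i≡j _ _ (trans (sym (Q-value x)) (Q≈𝟘 x))

    symmetric : IsSymmetric S
    symmetric x with ℤP.≤-total c 0ℤ
    ... | inj₁ c≤0 = trans (c≤0⇒constant c≤0 (x ⁻¹)) (sym (c≤0⇒constant c≤0 x))
    ... | inj₂ c≥0 = c≥0⇒symmetric c≥0 x

    k²≡v*m+c : k * k ≡ v * m + c
    k²≡v*m+c = begin
      k * k                                 ≡⟨ sym (∑G-⋆ s s) ⟩
      ∑G (s ⋆ s)                            ≡⟨ ∑G-cong (λ a → trans (s⋆s≈m𝕁⊕cδ a) (m𝕁⊕cδ-value a)) ⟩
      ∑G (λ a → m + c * δ ε a)              ≡⟨ ∑G-+ (λ _ → m) (λ a → c * δ ε a) ⟩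
      ∑G (λ _ → m) + ∑G (λ a → c * δ ε a)   ≡⟨ cong₂ _+_ (∑G-const m) (∑G-*ˡ c (δ ε)) ⟩
      v * m + c * ∑G (δ ε)                  ≡⟨ cong (λ z → v * m + c * z) (∑G-δ ε) ⟩
      v * m + c * 1ℤ                        ≡⟨ cong (_+_ (v * m)) (ℤP.*-identityʳ c) ⟩
      v * m + c                             ∎
      where open ≡-Reasoning

    differenceSet : IsDifferenceSet S
    differenceSet = μ , λ a a≢ε → ℤP.+-injective (begin
      + #quotients S a      ≡⟨ +#quotients≡𝟙S⋆reflect𝟙S S a ⟩
      (s ⋆ t) a             ≡⟨ ⋆-cong {s} {s} {t} {s} (λ _ → refl) (λ x → cong χ (symmetric x)) a ⟩
      (s ⋆ s) a             ≡⟨ sym (+#products≡𝟙S⋆𝟙S S a) ⟩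
      + #products S a       ≡⟨ cong +_ (proj₂ sumSet a a≢ε) ⟩
      + μ                   ∎)
      where open ≡-Reasoning

module SquareRootParity (G : FiniteAbelianGroup) where

  open import Data.Integer using (ℤ; +_; _+_; _*_)
  import Data.Integer.Properties as ℤP
  open import Data.Product using (Σ; _,_; proj₁; proj₂)
  open import Relation.Binary.PropositionalEquality
  open IntegerSums using (sum²-symmetric-≡-diagonal+even)
  open Indicators
  open GroupAlgebra G
  open PairCounts G

  #rootsIn : Subset → ℤ[G]
  #rootsIn S h = ∑G (λ x → 𝟙 S x * ⟦ (x ∙ x) ≟ h ⟧)

  μ≡#rootsIn+even : ∀ S (sumSet : IsSumSet S) h → h ≢ ε → Σ ℤ λ n → + proj₁ sumSet ≡ #rootsIn S h + (n + n)
  μ≡#rootsIn+even S sumSet h h≢ε = n , (begin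
    + proj₁ sumSet                ≡⟨ cong +_ (sym (proj₂ sumSet h h≢ε)) ⟩
    + #products S h               ≡⟨ +#pairs≡∑∑ S _∙_ h ⟩
    ∑G (λ x → ∑G (λ y → w x y))   ≡⟨ proj₂ split ⟩
    ∑G (λ x → w x x) + (n + n)    ≡⟨ cong (_+ (n + n)) (∑G-cong diagonal) ⟩
    #rootsIn S h + (n + n)        ∎)
    where
    open ≡-Reasoning
    w : Carrier → Carrier → ℤ
    w x y = 𝟙 S x * 𝟙 S y * ⟦ (x ∙ y) ≟ h ⟧
    w-sym : ∀ x y → w x y ≡ w y x
    w-sym x y rewrite comm x y = cong (_* ⟦ (y ∙ x) ≟ h ⟧) (ℤP.*-comm (𝟙 S x) (𝟙 S y))
    split = sum²-symmetric-≡-diagonal+even (λ i j → w (fromFin i) (fromFin j))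
                                           (λ i j → w-sym (fromFin i) (fromFin j))
    n = proj₁ split
    diagonal : ∀ x → w x x ≡ 𝟙 S x * ⟦ (x ∙ x) ≟ h ⟧
    diagonal x = cong (_* ⟦ (x ∙ x) ≟ h ⟧) (χb*χb≡χb (S x))

module NoInvolution (G : FiniteAbelianGroup) where

  open import Data.Integer using (+_; _+_; _*_; 0ℤ)
  import Data.Integer.Properties as ℤP
  open import Data.Product using (proj₁; proj₂)
  open import Relation.Binary.PropositionalEquality
  open Indicators
  open GroupAlgebra G
  open SquareRootParity G
  open TrivialSubsets G

  module _ (no-involution : ∀ z → z ∙ z ≡ ε → z ≡ ε) (S : Subset) (sumSet : IsSumSet S) where

    #rootsIn-square : ∀ z → #rootsIn S (z ∙ z) ≡ 𝟙 S z
    #rootsIn-square z = trans (∑G-zero-except _ z off-z) at-z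
      where
      off-z : ∀ x → x ≢ z → 𝟙 S x * ⟦ (x ∙ x) ≟ (z ∙ z) ⟧ ≡ 0ℤ
      off-z x x≢z rewrite ⟦⟧-no ((x ∙ x) ≟ (z ∙ z))
        (λ x²≡z² → x≢z (x∙y⁻¹≈ε⇒x≈y x z (no-involution _ (x∙x≡y∙y⇒[x∙y⁻¹]²≡ε x z x²≡z²)))) =
        ℤP.*-zeroʳ (𝟙 S x)
      at-z : 𝟙 S z * ⟦ (z ∙ z) ≟ (z ∙ z) ⟧ ≡ 𝟙 S z
      at-z rewrite ⟦⟧-yes ((z ∙ z) ≟ (z ∙ z)) refl = ℤP.*-identityʳ (𝟙 S z)

    constant-off-ε : ∀ a b → a ≢ ε → b ≢ ε → S a ≡ S b
    constant-off-ε a b a≢ε b≢ε = χa+even≡χb+even⇒a≡b (S a) (S b) (proj₁ pa) (proj₁ pb) (begin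
      χ (S a) + (proj₁ pa + proj₁ pa)             ≡⟨ cong (_+ (proj₁ pa + proj₁ pa)) (sym (#rootsIn-square a)) ⟩
      #rootsIn S (a ∙ a) + (proj₁ pa + proj₁ pa)  ≡⟨ sym (proj₂ pa) ⟩
      + proj₁ sumSet                              ≡⟨ proj₂ pb ⟩
      #rootsIn S (b ∙ b) + (proj₁ pb + proj₁ pb)  ≡⟨ cong (_+ (proj₁ pb + proj₁ pb)) (#rootsIn-square b) ⟩
      χ (S b) + (proj₁ pb + proj₁ pb)             ∎)
      where
      open ≡-Reasoning
      pa = μ≡#rootsIn+even S sumSet (a ∙ a) (λ a²≡ε → a≢ε (no-involution a a²≡ε))
      pb = μ≡#rootsIn+even S sumSet (b ∙ b) (λ b²≡ε → b≢ε (no-involution b b²≡ε))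

    trivial : IsTrivial S
    trivial = constant-off⇒trivial S ε (identityˡ ε) constant-off-ε

module UniqueInvolution (G : FiniteAbelianGroup) where

  open import Data.Integer using (ℤ; +_; -_; _+_; _*_; _-_; 0ℤ; 1ℤ)
  import Data.Integer.Properties as ℤP
  open import Data.Bool as Bool using (true; false)
  open import Data.Product using (Σ; _,_; proj₁; proj₂)
  open import Data.Sum using (_⊎_; inj₁; inj₂; [_,_]′)
  open import Data.Empty using (⊥-elim)
  open import Relation.Nullary using (yes; no)
  open import Relation.Binary.PropositionalEquality
  open import Data.Integer.Solver using (module +-*-Solver)
  open Indicators
  open GroupAlgebra G
  open PairCounts G
  open SumSetSymmetry G using (module SumSet)
  open SquareRootParity G
  open Fibres G
  open TrivialSubsets G

  module _ (t : Carrier) (t≢ε : t ≢ ε) (t²≡ε : t ∙ t ≡ ε) (unique : ∀ z → z ∙ z ≡ ε → z ≢ ε → z ≡ t) where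

    t⁻¹≡t : t ⁻¹ ≡ t
    t⁻¹≡t = sym (inverseʳ-unique t t t²≡ε)

    [z∙t]²≡z² : ∀ z → (z ∙ t) ∙ (z ∙ t) ≡ z ∙ z
    [z∙t]²≡z² z = begin
      (z ∙ t) ∙ (z ∙ t)  ≡⟨ assoc z t (z ∙ t) ⟩
      z ∙ (t ∙ (z ∙ t))  ≡⟨ cong (z ∙_) (sym (assoc t z t)) ⟩
      z ∙ ((t ∙ z) ∙ t)  ≡⟨ cong (λ u → z ∙ (u ∙ t)) (comm t z) ⟩
      z ∙ ((z ∙ t) ∙ t)  ≡⟨ cong (z ∙_) (assoc z t t) ⟩
      z ∙ (z ∙ (t ∙ t))  ≡⟨ cong (λ u → z ∙ (z ∙ u)) t²≡ε ⟩
      z ∙ (z ∙ ε)        ≡⟨ cong (z ∙_) (identityʳ z) ⟩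
      z ∙ z              ∎
      where open ≡-Reasoning

    square-roots : ∀ z x → x ∙ x ≡ z ∙ z → x ≡ z ⊎ x ≡ z ∙ t
    square-roots z x x²≡z² with (x ∙ z ⁻¹) ≟ ε
    ... | yes x∙z⁻¹≡ε = inj₁ (x∙y⁻¹≈ε⇒x≈y x z x∙z⁻¹≡ε)
    ... | no x∙z⁻¹≢ε  = inj₂ (begin
      x               ≡⟨ sym (x∙[x⁻¹∙y]≡y z x) ⟩
      z ∙ (z ⁻¹ ∙ x)  ≡⟨ cong (z ∙_) (comm (z ⁻¹) x) ⟩
      z ∙ (x ∙ z ⁻¹)  ≡⟨ cong (z ∙_) (unique _ (x∙x≡y∙y⇒[x∙y⁻¹]²≡ε x z x²≡z²) x∙z⁻¹≢ε) ⟩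
      z ∙ t           ∎)
      where open ≡-Reasoning

    involutions : ∀ z → z ∙ z ≡ ε → z ≡ ε ⊎ z ≡ t
    involutions z z²≡ε with z ≟ ε
    ... | yes z≡ε = inj₁ z≡ε
    ... | no z≢ε  = inj₂ (unique z z²≡ε z≢ε)

    z≢z∙t : ∀ z → z ≢ z ∙ t
    z≢z∙t z z≡z∙t = t≢ε (begin
      t               ≡⟨ sym (x⁻¹∙[x∙y]≡y z t) ⟩
      z ⁻¹ ∙ (z ∙ t)  ≡⟨ cong (z ⁻¹ ∙_) (sym z≡z∙t) ⟩
      z ⁻¹ ∙ z        ≡⟨ inverseˡ z ⟩
      ε               ∎)
      where open ≡-Reasoning

    module _ (S : Subset) (sumSet : IsSumSet S) where
      open SumSet S sumSet hiding (t)

      -- Squaring is not injective, so some h is not a square; it has no roots in S, so μ is even.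
      μ-even : Σ ℤ λ n → + μ ≡ n + n
      μ-even = n , trans (proj₂ parity) (trans (cong (_+ (n + n)) no-roots) (ℤP.+-identityˡ (n + n)))
        where
        non-square = nonInjective⇒nonSurjective (λ x → x ∙ x) ε t (λ ε≡t → t≢ε (sym ε≡t))
                                                (trans (identityˡ ε) (sym t²≡ε))
        h = proj₁ non-square
        h≢ε : h ≢ ε
        h≢ε h≡ε = proj₂ non-square ε (trans (identityˡ ε) (sym h≡ε))
        parity = μ≡#rootsIn+even S sumSet h h≢ε
        n = proj₁ parity
        no-roots : #rootsIn S h ≡ 0ℤ
        no-root : ∀ x → 𝟙 S x * ⟦ (x ∙ x) ≟ h ⟧ ≡ 0ℤ
        no-root x rewrite ⟦⟧-no ((x ∙ x) ≟ h) (proj₂ non-square x) = ℤP.*-zeroʳ (𝟙 S x)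
        no-roots = trans (∑G-cong no-root) (trans (∑G-const 0ℤ) (ℤP.*-zeroʳ (+ order)))

      #rootsIn-of-square : ∀ z → #rootsIn S (z ∙ z) ≡ 𝟙 S z + 𝟙 S (z ∙ t)
      #rootsIn-of-square z = trans (∑G-zero-except-two _ z (z ∙ t) (z≢z∙t z) off)
                                   (cong₂ _+_ (root z refl) (root (z ∙ t) ([z∙t]²≡z² z)))
        where
        off : ∀ x → x ≢ z → x ≢ z ∙ t → 𝟙 S x * ⟦ (x ∙ x) ≟ (z ∙ z) ⟧ ≡ 0ℤ
        off x x≢z x≢zt
          rewrite ⟦⟧-no ((x ∙ x) ≟ (z ∙ z)) (λ x²≡z² → [ x≢z , x≢zt ]′ (square-roots z x x²≡z²)) =
          ℤP.*-zeroʳ (𝟙 S x)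
        root : ∀ x → x ∙ x ≡ z ∙ z → 𝟙 S x * ⟦ (x ∙ x) ≟ (z ∙ z) ⟧ ≡ 𝟙 S x
        root x x²≡z² rewrite ⟦⟧-yes ((x ∙ x) ≟ (z ∙ z)) x²≡z² = ℤP.*-identityʳ (𝟙 S x)

      t-invariant-off-involutions : ∀ z → z ∙ z ≢ ε → S z ≡ S (z ∙ t)
      t-invariant-off-involutions z z²≢ε =
        χa+χb+even≡even⇒a≡b (S z) (S (z ∙ t)) n (proj₁ μ-even) (begin
          (𝟙 S z + 𝟙 S (z ∙ t)) + (n + n)  ≡⟨ cong (_+ (n + n)) (sym (#rootsIn-of-square z)) ⟩
          #rootsIn S (z ∙ z) + (n + n)      ≡⟨ sym (proj₂ parity) ⟩
          + μ                               ≡⟨ proj₂ μ-even ⟩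
          proj₁ μ-even + proj₁ μ-even       ∎)
        where
        open ≡-Reasoning
        parity = μ≡#rootsIn+even S sumSet (z ∙ z) z²≢ε
        n = proj₁ parity

      t-invariant : S ε ≡ S t → ∀ z → S (z ∙ t) ≡ S z
      t-invariant Sε≡St z with (z ∙ z) ≟ ε
      ... | no z²≢ε = sym (t-invariant-off-involutions z z²≢ε)
      ... | yes z²≡ε with involutions z z²≡ε
      ...   | inj₁ refl = trans (cong S (identityˡ t)) (sym Sε≡St)
      ...   | inj₂ refl = trans (cong S t²≡ε) Sε≡St

      [s⋆s]t≡m : (s ⋆ s) t ≡ m
      [s⋆s]t≡m = trans (sym (+#products≡𝟙S⋆𝟙S S t)) (cong +_ (proj₂ sumSet t t≢ε))

      Sε≡St⇒trivial : S ε ≡ S t → IsTrivial S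
      Sε≡St⇒trivial Sε≡St = constant⇒trivial S ε (c≤0⇒constant (ℤP.≤-reflexive c≡0))
        where
        [s⋆s]t≡[s⋆s]ε : (s ⋆ s) t ≡ (s ⋆ s) ε
        [s⋆s]t≡[s⋆s]ε = ∑G-cong (λ x → cong (λ u → 𝟙 S x * χ u)
          (trans (t-invariant Sε≡St (x ⁻¹)) (cong S (sym (identityʳ (x ⁻¹))))))
        c≡0 : c ≡ 0ℤ
        c≡0 = ℤP.i≡j⇒i-j≡0 (trans (sym [s⋆s]t≡[s⋆s]ε) [s⋆s]t≡m)

      -- Now c = 1 and k = μ + 1, so k² = vμ + c leaves μ = 0 (a singleton) or μ = v − 2 (a cosingleton).
      module _ (Sε≢St : S ε ≢ S t) where

        [s⋆s]ε-[s⋆s]t≡1 : (s ⋆ s) ε - (s ⋆ s) t ≡ 1ℤ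
        [s⋆s]ε-[s⋆s]t≡1 = begin
          (s ⋆ s) ε - (s ⋆ s) t                              ≡⟨ sym ∑g≡[s⋆s]ε-[s⋆s]t ⟩
          ∑G g                                               ≡⟨ ∑G-zero-except-two g ε t (λ ε≡t → t≢ε (sym ε≡t)) g-off ⟩
          g ε + g t                                          ≡⟨ cong₂ _+_ gε gt ⟩
          (s ε * s ε - s ε * s t) + (s t * s t - s t * s ε)  ≡⟨ distinct-bits (S ε) (S t) Sε≢St ⟩
          1ℤ                                                 ∎
          where
          open ≡-Reasoning
          g : ℤ[G]
          g x = s x * s (x ⁻¹ ∙ ε) - s x * s (x ⁻¹ ∙ t)
          ∑g≡[s⋆s]ε-[s⋆s]t : ∑G g ≡ (s ⋆ s) ε - (s ⋆ s) t
          ∑g≡[s⋆s]ε-[s⋆s]t = trans (∑G-+ (λ x → s x * s (x ⁻¹ ∙ ε)) (λ x → - (s x * s (x ⁻¹ ∙ t))))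
                                   (cong (_+_ ((s ⋆ s) ε)) (∑G-neg (λ x → s x * s (x ⁻¹ ∙ t))))
          g-off : ∀ x → x ≢ ε → x ≢ t → g x ≡ 0ℤ
          g-off x x≢ε x≢t =
            trans (cong (λ u → s x * χ u - s x * s (x ⁻¹ ∙ t))
                        (trans (cong S (identityʳ (x ⁻¹))) (t-invariant-off-involutions (x ⁻¹) x⁻¹²≢ε)))
                  (ℤP.+-inverseʳ (s x * s (x ⁻¹ ∙ t)))
            where
            x⁻¹²≢ε : (x ⁻¹) ∙ (x ⁻¹) ≢ ε
            x⁻¹²≢ε x⁻¹²≡ε with involutions (x ⁻¹) x⁻¹²≡ε
            ... | inj₁ x⁻¹≡ε = x≢ε (trans (sym (⁻¹-involutive x)) (trans (cong _⁻¹ x⁻¹≡ε) ε⁻¹≈ε))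
            ... | inj₂ x⁻¹≡t = x≢t (trans (sym (⁻¹-involutive x)) (trans (cong _⁻¹ x⁻¹≡t) t⁻¹≡t))
          gε : g ε ≡ s ε * s ε - s ε * s t
          gε = cong₂ (λ u w → s ε * χ u - s ε * χ w) (cong S (ε⁻¹∙x≡x ε)) (cong S (ε⁻¹∙x≡x t))
          gt : g t ≡ s t * s t - s t * s ε
          gt = cong₂ (λ u w → s t * χ u - s t * χ w) (cong S (trans (identityʳ (t ⁻¹)) t⁻¹≡t)) (cong S (inverseˡ t))
          distinct-bits : ∀ a b → a ≢ b → (χ a * χ a - χ a * χ b) + (χ b * χ b - χ b * χ a) ≡ 1ℤ
          distinct-bits true  true  a≢b = ⊥-elim (a≢b refl)
          distinct-bits false false a≢b = ⊥-elim (a≢b refl)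
          distinct-bits true  false _   = refl
          distinct-bits false true  _   = refl

        c≡1 : c ≡ 1ℤ
        c≡1 = trans (cong (λ u → (s ⋆ s) ε - u) (sym [s⋆s]t≡m)) [s⋆s]ε-[s⋆s]t≡1

        [s⋆s]ε≡k : (s ⋆ s) ε ≡ k
        [s⋆s]ε≡k = ∑G-cong (λ x → trans (cong (λ u → s x * χ u) (trans (cong S (identityʳ (x ⁻¹))) (symmetric x)))
                                        (χb*χb≡χb (S x)))

        k≡m+1 : k ≡ m + 1ℤ
        k≡m+1 = begin
          k            ≡⟨ sym [s⋆s]ε≡k ⟩
          (s ⋆ s) ε    ≡⟨ solve 2 (λ σ m → σ := m :+ (σ :- m)) refl ((s ⋆ s) ε) m ⟩
          m + c        ≡⟨ cong (_+_ m) c≡1 ⟩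
          m + 1ℤ       ∎
          where
          open ≡-Reasoning
          open +-*-Solver using (solve; _:=_; _:+_; _:-_)

        m[m+2-v]≡0 : m * (m + + 2 - v) ≡ 0ℤ
        m[m+2-v]≡0 = begin
          m * (m + + 2 - v)                   ≡⟨ solve 2 (λ m v → m :* (m :+ con (+ 2) :- v) :=
                                                   (m :+ con 1ℤ) :* (m :+ con 1ℤ) :- (v :* m :+ con 1ℤ)) refl m v ⟩
          (m + 1ℤ) * (m + 1ℤ) - (v * m + 1ℤ)  ≡⟨ cong₂ (λ a b → a * a - (v * m + b)) (sym k≡m+1) (sym c≡1) ⟩
          k * k - (v * m + c)                 ≡⟨ ℤP.i≡j⇒i-j≡0 k²≡v*m+c ⟩
          0ℤ                                  ∎
          where
          open ≡-Reasoning
          open +-*-Solver using (solve; _:=_; _:+_; _:-_; _:*_; con)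

        k≡1⇐m≡0 : m ≡ 0ℤ → k ≡ 1ℤ
        k≡1⇐m≡0 m≡0 = trans k≡m+1 (cong (_+ 1ℤ) m≡0)

        k+1≡v⇐m+2-v≡0 : m + + 2 - v ≡ 0ℤ → k + 1ℤ ≡ v
        k+1≡v⇐m+2-v≡0 m+2-v≡0 = begin
          k + 1ℤ       ≡⟨ cong (_+ 1ℤ) k≡m+1 ⟩
          m + 1ℤ + 1ℤ  ≡⟨ ℤP.+-assoc m 1ℤ 1ℤ ⟩
          m + + 2      ≡⟨ ℤP.i-j≡0⇒i≡j (m + + 2) v m+2-v≡0 ⟩
          v            ∎
          where open ≡-Reasoning

        Sε≢St⇒trivial : IsTrivial S
        Sε≢St⇒trivial with ℤP.i*j≡0⇒i≡0∨j≡0 m m[m+2-v]≡0 | S ε in Sε | S t in St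
        ... | _     | true  | true  = ⊥-elim (Sε≢St (trans Sε (sym St)))
        ... | _     | false | false = ⊥-elim (Sε≢St (trans Sε (sym St)))
        ... | inj₁ m≡0 | true  | false =
          singleton⇒trivial S ε (identityˡ ε) Sε (∑𝟙≡1⇒singleton S (k≡1⇐m≡0 m≡0) ε Sε)
        ... | inj₁ m≡0 | false | true  =
          singleton⇒trivial S t t²≡ε St (∑𝟙≡1⇒singleton S (k≡1⇐m≡0 m≡0) t St)
        ... | inj₂ m+2-v≡0 | false | true  =
          cosingleton⇒trivial S ε (identityˡ ε) Sε (∑𝟙+1≡order⇒cosingleton S (k+1≡v⇐m+2-v≡0 m+2-v≡0) ε Sε)
        ... | inj₂ m+2-v≡0 | true  | false =
          cosingleton⇒trivial S t t²≡ε St (∑𝟙+1≡order⇒cosingleton S (k+1≡v⇐m+2-v≡0 m+2-v≡0) t St)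

      trivial : IsTrivial S
      trivial with S ε Bool.≟ S t
      ... | yes Sε≡St = Sε≡St⇒trivial Sε≡St
      ... | no Sε≢St  = Sε≢St⇒trivial Sε≢St

module CyclicGroups (G : FiniteAbelianGroup) where

  open import Data.Nat as ℕ using (ℕ; zero; suc; _+_; _*_; _∸_; _<_; _≤_; z≤n; s≤s)
  import Data.Nat.Properties as ℕP
  open import Data.Nat.DivMod using (_%_; _/_; m≡m%n+[m/n]*n; m%n<n)
  open import Data.Fin using (Fin; toℕ)
  open import Data.Fin.Properties using (pigeonhole)
  open import Data.Integer using (ℤ; +_; -[1+_])
  open import Data.Product using (Σ; _×_; _,_; proj₁; proj₂)
  open import Data.Empty using (⊥-elim)
  open import Relation.Nullary using (yes; no; ¬?)
  open import Relation.Nullary.Decidable using (decidable-stable; _×-dec_)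
  open import Relation.Unary using (Decidable)
  open import Relation.Binary.PropositionalEquality
  open import Relation.Binary.Definitions using (tri<; tri≈; tri>)
  open GroupAlgebra G
  open LeastWitness

  m+m≡n+n⇒m≡n : ∀ m n → m + m ≡ n + n → m ≡ n
  m+m≡n+n⇒m≡n m n eq with ℕP.<-cmp m n
  ... | tri≈ _ m≡n _ = m≡n
  ... | tri< m<n _ _ = ⊥-elim (ℕP.<-irrefl eq (ℕP.+-mono-< m<n m<n))
  ... | tri> _ _ n<m = ⊥-elim (ℕP.<-irrefl (sym eq) (ℕP.+-mono-< n<m n<m))

  ^ℕ-+ : ∀ x a b → x ^ℕ (a + b) ≡ x ^ℕ a ∙ x ^ℕ b
  ^ℕ-+ x zero    b = sym (identityˡ _)
  ^ℕ-+ x (suc a) b = trans (cong (x ∙_) (^ℕ-+ x a b)) (sym (assoc x _ _))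

  ε^ℕn≡ε : ∀ n → ε ^ℕ n ≡ ε
  ε^ℕn≡ε zero    = refl
  ε^ℕn≡ε (suc n) = trans (identityˡ _) (ε^ℕn≡ε n)

  ^ℕ-* : ∀ x a b → x ^ℕ (a * b) ≡ (x ^ℕ a) ^ℕ b
  ^ℕ-* x a zero    rewrite ℕP.*-zeroʳ a = refl
  ^ℕ-* x a (suc b) = begin
    x ^ℕ (a * suc b)        ≡⟨ cong (x ^ℕ_) (ℕP.*-suc a b) ⟩
    x ^ℕ (a + a * b)        ≡⟨ ^ℕ-+ x a (a * b) ⟩
    x ^ℕ a ∙ x ^ℕ (a * b)   ≡⟨ cong (x ^ℕ a ∙_) (^ℕ-* x a b) ⟩
    x ^ℕ a ∙ (x ^ℕ a) ^ℕ b  ∎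
    where open ≡-Reasoning

  x∙y≡x⇒y≡ε : ∀ x y → x ∙ y ≡ x → y ≡ ε
  x∙y≡x⇒y≡ε x y x∙y≡x = trans (sym (x⁻¹∙[x∙y]≡y x y)) (trans (cong (x ⁻¹ ∙_) x∙y≡x) (inverseˡ x))

  module _ (g : Carrier) where

    IsPeriod : ℕ → Set
    IsPeriod n = 0 < n × g ^ℕ n ≡ ε

    isPeriod? : Decidable IsPeriod
    isPeriod? zero    = no (λ ())
    isPeriod? (suc n) with (g ^ℕ suc n) ≟ ε
    ... | yes gⁿ≡ε = yes (s≤s z≤n , gⁿ≡ε)
    ... | no gⁿ≢ε  = no (λ (_ , gⁿ≡ε) → gⁿ≢ε gⁿ≡ε)

    -- Among g⁰, …, g^|G| two powers coincide.
    period : Σ ℕ IsPeriod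
    period with pigeonhole (ℕP.n<1+n order) (λ (i : Fin (suc order)) → toFin (g ^ℕ toℕ i))
    ... | i , j , i<j , same = toℕ j ∸ toℕ i , ℕP.m<n⇒0<n∸m i<j ,
      x∙y≡x⇒y≡ε (g ^ℕ toℕ i) _ (begin
        g ^ℕ toℕ i ∙ g ^ℕ (toℕ j ∸ toℕ i)  ≡⟨ sym (^ℕ-+ g (toℕ i) _) ⟩
        g ^ℕ (toℕ i + (toℕ j ∸ toℕ i))     ≡⟨ cong (g ^ℕ_) (ℕP.m+[n∸m]≡n (ℕP.<⇒≤ i<j)) ⟩
        g ^ℕ toℕ j                         ≡⟨ toFin-injective (sym same) ⟩
        g ^ℕ toℕ i                         ∎)
      where open ≡-Reasoning

    opaque
      order-of : Σ ℕ (Least IsPeriod)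
      order-of = least-witness isPeriod? (proj₁ period) (proj₂ period)

  module Cyclic (g : Carrier) (generates : ∀ x → Σ ℤ λ n → g ^ n ≡ x) where

    d : ℕ
    d = proj₁ (order-of g)

    d>0 : 0 < d
    d>0 = proj₁ (proj₁ (proj₂ (order-of g)))

    gᵈ≡ε : g ^ℕ d ≡ ε
    gᵈ≡ε = proj₂ (proj₁ (proj₂ (order-of g)))

    d-least : ∀ k → 0 < k → g ^ℕ k ≡ ε → d ≤ k
    d-least k k>0 gᵏ≡ε = proj₂ (proj₂ (order-of g)) k (k>0 , gᵏ≡ε)

    gᵃ≡g^[a%d] : ∀ a → g ^ℕ a ≡ g ^ℕ (_%_ a d {{ℕ.>-nonZero d>0}})
    gᵃ≡g^[a%d] a = begin
      g ^ℕ a                   ≡⟨ cong (g ^ℕ_) (m≡m%n+[m/n]*n a d) ⟩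
      g ^ℕ (r + q * d)         ≡⟨ ^ℕ-+ g r (q * d) ⟩
      g ^ℕ r ∙ g ^ℕ (q * d)    ≡⟨ cong (g ^ℕ r ∙_) (trans (cong (g ^ℕ_) (ℕP.*-comm q d)) (^ℕ-* g d q)) ⟩
      g ^ℕ r ∙ (g ^ℕ d) ^ℕ q   ≡⟨ cong (λ u → g ^ℕ r ∙ u ^ℕ q) gᵈ≡ε ⟩
      g ^ℕ r ∙ ε ^ℕ q          ≡⟨ cong (g ^ℕ r ∙_) (ε^ℕn≡ε q) ⟩
      g ^ℕ r ∙ ε               ≡⟨ identityʳ (g ^ℕ r) ⟩
      g ^ℕ r                   ∎
      where
      open ≡-Reasoning
      instance _ = ℕ.>-nonZero d>0
      r = a % d
      q = a / d

    -- An involution equals its inverse, so a negative exponent can be replaced by a positive one.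
    involution-as-power : ∀ x → x ∙ x ≡ ε → Σ ℕ λ a → g ^ℕ a ≡ x
    involution-as-power x x²≡ε with generates x
    ... | + a      , gᵃ≡x   = a , gᵃ≡x
    ... | -[1+ a ] , g⁻ᵃ≡x = suc a , (begin
      g ^ℕ suc a          ≡⟨ sym (⁻¹-involutive _) ⟩
      (g ^ℕ suc a) ⁻¹ ⁻¹  ≡⟨ cong _⁻¹ g⁻ᵃ≡x ⟩
      x ⁻¹                ≡⟨ sym (inverseʳ-unique x x x²≡ε) ⟩
      x                   ∎)
      where open ≡-Reasoning

    -- Write x = g ^ℕ r with 0 < r < d; then d ≤ r + r, and r + r ∸ d < d is a period unless it is 0.
    involution-at-half-order : ∀ x → x ∙ x ≡ ε → x ≢ ε → Σ ℕ λ r → r + r ≡ d × g ^ℕ r ≡ x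
    involution-at-half-order x x²≡ε x≢ε = r , ℕP.≤-antisym r+r≤d d≤r+r , gʳ≡x
      where
      instance _ = ℕ.>-nonZero d>0
      a = proj₁ (involution-as-power x x²≡ε)
      r = a % d
      gʳ≡x : g ^ℕ r ≡ x
      gʳ≡x = trans (sym (gᵃ≡g^[a%d] a)) (proj₂ (involution-as-power x x²≡ε))
      r>0 : 0 < r
      r>0 = ℕP.n≢0⇒n>0 (λ r≡0 → x≢ε (trans (sym gʳ≡x) (cong (g ^ℕ_) r≡0)))
      g^[r+r]≡ε : g ^ℕ (r + r) ≡ ε
      g^[r+r]≡ε = trans (^ℕ-+ g r r) (trans (cong₂ _∙_ gʳ≡x gʳ≡x) x²≡ε)
      d≤r+r : d ≤ r + r
      d≤r+r = d-least (r + r) (ℕP.<-≤-trans r>0 (ℕP.m≤m+n r r)) g^[r+r]≡ε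
      excess<d : r + r ∸ d < d
      excess<d = ℕP.m<n+o⇒m∸n<o (r + r) d (ℕP.+-mono-< (m%n<n a d) (m%n<n a d))
      g^excess≡ε : g ^ℕ (r + r ∸ d) ≡ ε
      g^excess≡ε = x∙y≡x⇒y≡ε (g ^ℕ d) _ (begin
        g ^ℕ d ∙ g ^ℕ (r + r ∸ d)  ≡⟨ sym (^ℕ-+ g d _) ⟩
        g ^ℕ (d + (r + r ∸ d))     ≡⟨ cong (g ^ℕ_) (ℕP.m+[n∸m]≡n d≤r+r) ⟩
        g ^ℕ (r + r)               ≡⟨ trans g^[r+r]≡ε (sym gᵈ≡ε) ⟩
        g ^ℕ d                     ∎)
        where open ≡-Reasoning
      r+r≤d : r + r ≤ d
      r+r≤d with (r + r ∸ d) ℕ.≟ 0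
      ... | yes excess≡0 = ℕP.m∸n≡0⇒m≤n excess≡0
      ... | no excess≢0  = ⊥-elim (ℕP.<⇒≱ excess<d (d-least _ (ℕP.n≢0⇒n>0 excess≢0) g^excess≡ε))

    at-most-one-involution : ∀ x y → x ∙ x ≡ ε → y ∙ y ≡ ε → x ≢ ε → y ≢ ε → x ≡ y
    at-most-one-involution x y x²≡ε y²≡ε x≢ε y≢ε
      with involution-at-half-order x x²≡ε x≢ε | involution-at-half-order y y²≡ε y≢ε
    ... | r , r+r≡d , gʳ≡x | r′ , r′+r′≡d , gʳ′≡y =
      trans (sym gʳ≡x) (trans (cong (g ^ℕ_) (m+m≡n+n⇒m≡n r r′ (trans r+r≡d (sym r′+r′≡d)))) gʳ′≡y)

  cyclic⇒sumSet-trivial : IsCyclic → ∀ S → IsSumSet S → IsTrivial S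
  cyclic⇒sumSet-trivial (g , generates) S sumSet with any?G (λ t → ¬? (t ≟ ε) ×-dec ((t ∙ t) ≟ ε))
  ... | yes (t , t≢ε , t²≡ε) = UniqueInvolution.trivial G t t≢ε t²≡ε
    (λ z z²≡ε z≢ε → Cyclic.at-most-one-involution g generates z t z²≡ε t²≡ε z≢ε t≢ε) S sumSet
  ... | no ∄involution = NoInvolution.trivial G
    (λ z z²≡ε → decidable-stable (z ≟ ε) (λ z≢ε → ∄involution (z , z≢ε , z²≡ε))) S sumSet

sumSet⇒differenceSet×symmetric : (G : FiniteAbelianGroup) (S : FiniteAbelianGroup.Subset G) →
  FiniteAbelianGroup.IsSumSet G S →
  FiniteAbelianGroup.IsDifferenceSet G S × FiniteAbelianGroup.IsSymmetric G S
sumSet⇒differenceSet×symmetric G S sumSet = differenceSet , symmetric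
  where open SumSetSymmetry.SumSet G S sumSet

corollary4p5 : ((G : FiniteAbelianGroup) → (S : FiniteAbelianGroup.Subset G) →
    FiniteAbelianGroup.IsSumSet G S → FiniteAbelianGroup.IsNontrivial G S →
    FiniteAbelianGroup.IsDifferenceSet G S × FiniteAbelianGroup.IsSymmetric G S)
    × ((G : FiniteAbelianGroup) → FiniteAbelianGroup.IsCyclic G →
    (S : FiniteAbelianGroup.Subset G) →
    ¬ (FiniteAbelianGroup.IsSumSet G S × FiniteAbelianGroup.IsNontrivial G S))
-- The first part does not need nontriviality: every sum set of a finite abelian group is symmetric.
corollary4p5 =
  (λ G S sumSet _ → sumSet⇒differenceSet×symmetric G S sumSet) ,
  (λ G cyclic S (sumSet , nontrivial) → nontrivial (CyclicGroups.cyclic⇒sumSet-trivial G cyclic S sumSet))
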